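{- Let $n>3$ and let $S=\{(1\,2\,i): 3\le i\le n\}$, a generating set of the alternating group $A_n$. Then the $G$-graph $\Gamma(A_n,S)$ is $(n-2)$-partite (its vertex set is partitioned into the $n-2$ classes $V_s$, $s\in S$, each containing no edge), $3(n-3)$-regular, has $|E|=\frac{n!(n-2)(n-3)}{4}$ edges and $|V|=\frac{n!(n-2)}{6}$ vertices.
   Context: For a group $G$ generated by a finite set $S$, the $G$-graph $\Gamma(G,S)$ has vertex set the disjoint union over $s\in S$ of the sets $V_s$ of right cosets $\langle s\rangle x$ ($x\in G$) of the cyclic subgroup $\langle s\rangle$; for $s\neq t$ in $S$, $\langle s\rangle x$ and $\langle t\rangle y$ are joined by exactly $|\langle s\rangle x\cap\langle t\rangle y|$ parallel edges; vertices in the same $V_s$ are non-adjacent and there are no loops. Degrees and edges counted with multiplicity. -}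

module Defs where

open import Data.Nat using (ℕ; zero; suc; _+_; _*_; _∸_; _<_)
open import Data.Nat.Divisibility using (_∣_)
open import Data.Fin using (Fin; zero; suc) renaming (_<_ to _<ᶠ_)
open import Data.Fin.Properties using (_≟_; _<?_)
open import Data.List using (List; map; allFin)
open import Data.Nat.ListAction using (sum)
open import Data.Bool using (Bool; true; false; if_then_else_; _∧_)
open import Data.Product using (Σ; ∃; _×_; _,_; proj₁; proj₂)
open import Relation.Nullary using (¬_; yes; no)
open import Relation.Nullary.Decidable using (⌊_⌋)
open import Relation.Binary.PropositionalEquality using (_≡_; _≢_; _≗_)
open import Function using (_∘_; id)
open import Function.Definitions using (Bijective)

-- Permutations of {1,…,n} are modelled on Fin n (point k ↔ Fin element k-1).
-- A group element is a map Fin n → Fin n; the product is composition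
-- (σ · τ = σ ∘ τ, τ applied first); equality is pointwise (_≗_).
Perm : ℕ → Set
Perm n = Fin n → Fin n

inversions : ∀ {n} → Perm n → ℕ
inversions {n} σ =
  sum (map (λ i → sum (map (λ j → if ⌊ i <? j ⌋ ∧ ⌊ σ j <? σ i ⌋ then 1 else 0)
                             (allFin n)))
           (allFin n))

InA : ∀ {n} → Perm n → Set
InA σ = Bijective _≡_ _≡_ σ × (2 ∣ inversions σ)

cyc3 : ∀ {n} → Fin n → Fin n → Fin n → Perm n
cyc3 a b c i with i ≟ a
... | yes _ = b
... | no _ with i ≟ b
...   | yes _ = c
...   | no _ with i ≟ c
...     | yes _ = a
...     | no _ = i

-- S = { (1 2 i) : 3 ≤ i ≤ n }, indexed by Fin (n ∸ 2): index j ↦ (1 2 (j+3)).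
gen : ∀ n → Fin (n ∸ 2) → Perm n
gen (suc (suc m)) j = cyc3 zero (suc zero) (suc (suc j))

pow : ∀ {n} → Perm n → ℕ → Perm n
pow s zero = id
pow s (suc k) = s ∘ pow s k

-- A vertex representative (s , x): the right coset ⟨s⟩x in V_s.
VRep : ℕ → Set
VRep n = Fin (n ∸ 2) × Perm n

-- g ∈ ⟨s⟩x   (⟨s⟩ = { s^k : k ∈ ℕ }, which is the cyclic subgroup since s has finite order)
_∈C_ : ∀ {n} → Perm n → VRep n → Set
_∈C_ {n} g (s , x) = ∃ λ k → g ≗ (pow (gen n s) k ∘ x)

IsVertex : ∀ n → VRep n → Set
IsVertex n (s , x) = InA x

_≈V_ : ∀ {n} → VRep n → VRep n → Set
(s , x) ≈V (t , y) = s ≡ t × (∀ g → (g ∈C (s , x) → g ∈C (t , y)) × (g ∈C (t , y) → g ∈C (s , x)))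

-- common element of the group in both cosets (one parallel edge per such element)
Common : ∀ {n} → VRep n → VRep n → Perm n → Set
Common v w g = InA g × g ∈C v × g ∈C w

Adjacent : ∀ n → VRep n → VRep n → Set
Adjacent n v w = proj₁ v ≢ proj₁ w × ∃ λ g → Common v w g

Partite : ℕ → Set
Partite n = ∀ v w → IsVertex n v → IsVertex n w → proj₁ v ≡ proj₁ w → ¬ Adjacent n v w

record HasCard {A : Set} (_~_ : A → A → Set) (P : A → Set) (m : ℕ) : Set where
  field
    elt      : Fin m → A
    elt-P    : ∀ i → P (elt i)
    elt-inj  : ∀ i j → elt i ~ elt j → i ≡ j
    elt-surj : ∀ a → P a → ∃ λ i → a ~ elt i

IncidentAt : ∀ n → VRep n → VRep n × Perm n → Set
IncidentAt n v (w , g) = IsVertex n w × proj₁ w ≢ proj₁ v × Common v w g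

_≈I_ : ∀ {n} → VRep n × Perm n → VRep n × Perm n → Set
(w , g) ≈I (w' , g') = w ≈V w' × g ≗ g'

-- edges: (v , w , g) with v ∈ V_s, w ∈ V_t, s < t (each unordered pair once), g ∈ v ∩ w
IsEdge : ∀ n → VRep n × VRep n × Perm n → Set
IsEdge n (v , w , g) = IsVertex n v × IsVertex n w × proj₁ v <ᶠ proj₁ w × Common v w g

_≈E_ : ∀ {n} → VRep n × VRep n × Perm n → VRep n × VRep n × Perm n → Set
(v , w , g) ≈E (v' , w' , g') = v ≈V v' × w ≈V w' × g ≗ g'

module Submission where

-- Partiteness is immediate: adjacency demands distinct classes.  Everything
-- else is counting, done by exhibiting duplicate-free lists (Enumeration):
--   * A_n is listed by building permutations from their first value and a
--     permutation of the rest; the inversion count grows by that first value,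
--     so each parity class has n!/2 members.
--   * s_j is even: an adjacent transposition flips the inversion parity, and
--     (0 1 c) is an even product of adjacent transpositions.  So x ↦ s_j x
--     maps A_n to itself, has order 3 and no fixed points; its orbits are the
--     cosets ⟨s_j⟩x, and a general orbit-splitting lemma (FreeOrbits) yields
--     |A_n|/3 vertices in each class, hence n!(n-2)/6 vertices.
--   * A vertex ⟨s_j⟩x meets, in each of the other n-3 classes, the cosets of
--     its three elements s_jʳx: degree 3(n-3).
--   * An edge is a group element g together with two classes a < b, so there
--     are |A_n| · (n-2)(n-3)/2 = n!(n-2)(n-3)/4 of them.

open import Data.Nat using (ℕ; zero; suc; _+_; _*_; _∸_; _<_; _≤_; z≤n; s≤s; _!; _/_; _<ᵇ_)
open import Data.Nat.Properties
  using (+-assoc; *-suc; *-assoc; *-comm; *-cancelʳ-≡; *-cancelˡ-≡; +-cancelʳ-≡; ≤-refl; ≤-trans; ≤-pred; ≤-reflexive;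
         ≮⇒≥; n≤1+n; n<1+n; <-irrefl; <-trans; 0≢1+n)
import Data.Nat.Properties as ℕₚ
open import Data.Nat.DivMod using (m*n/n≡m)
open import Data.Nat.Divisibility using (_∣_; divides)
open import Data.Nat.ListAction using (sum)
open import Data.Nat.Tactic.RingSolver using (solve-∀)
open import Data.Fin using (Fin; zero; suc; toℕ; fromℕ<; punchIn; punchOut) renaming (_<_ to _<ᶠ_)
open import Data.Fin.Properties
  using (punchInᵢ≢i; punchIn-injective; punchIn-punchOut; punchOut-punchIn; punchOut-injective; punchOut-cong;
         suc-injective; toℕ<n; toℕ-fromℕ<; _<?_; _≟_; toℕ-injective; all?)
open import Data.List using (List; []; _∷_; map; allFin; length; concatMap; lookup; filter; _++_)
open import Data.List.Properties using (length-map; map-tabulate; length-++; map-cong; length-tabulate; filter-all)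
open import Data.List.Membership.Propositional.Properties using (∈-lookup)
open import Data.List.Relation.Unary.All as All using (All; []; _∷_)
import Data.List.Relation.Unary.All.Properties as AllP
open import Data.List.Relation.Unary.Any as Any using (Any; here; there)
import Data.List.Relation.Unary.Any.Properties as AnyP
open import Data.List.Relation.Unary.AllPairs as AllPairs using (AllPairs; []; _∷_)
import Data.List.Relation.Unary.AllPairs.Properties as AllPairsP
open import Data.Bool using (Bool; true; false; not; _xor_; if_then_else_; _∧_)
open import Data.Bool.Properties
  using (not-involutive; not-injective; not-distribˡ-xor; xor-assoc; xor-comm; xor-same; xor-inverseˡ; xor-inverseʳ;
         xor-identityʳ)
open import Data.Product using (Σ; _×_; _,_; proj₁; proj₂)
open import Data.Sum using (_⊎_; inj₁; inj₂)
open import Data.Empty using (⊥; ⊥-elim)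
open import Relation.Nullary using (¬_; yes; no; Dec; does; ¬?)
open import Relation.Nullary.Decidable using (⌊_⌋; isYes≗does)
open import Relation.Binary.PropositionalEquality
open import Function using (_∘_; id)
open import Function.Definitions using (Bijective; Injective; Surjective)
open import Defs

-- Finite counting by duplicate-free lists.

record Enumeration {A : Set} (_~_ : A → A → Set) (P : A → Set) (L : List A) : Set where
  field
    entries-P : All P L
    distinct  : AllPairs (λ a b → ¬ a ~ b) L
    complete  : ∀ a → P a → Any (a ~_) L

lookup-injective : ∀ {A : Set} {_~_ : A → A → Set} → (∀ {a b} → a ~ b → b ~ a) →
  ∀ L → AllPairs (λ a b → ¬ a ~ b) L → ∀ i j → lookup L i ~ lookup L j → i ≡ j
lookup-injective sym~ (x ∷ L) (x≁ ∷ _) zero    zero    _ = refl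
lookup-injective sym~ (x ∷ L) (x≁ ∷ _) zero    (suc j) e = ⊥-elim (All.lookup x≁ (∈-lookup j) e)
lookup-injective sym~ (x ∷ L) (x≁ ∷ _) (suc i) zero    e = ⊥-elim (All.lookup x≁ (∈-lookup i) (sym~ e))
lookup-injective sym~ (x ∷ L) (_ ∷ d)  (suc i) (suc j) e = cong suc (lookup-injective sym~ L d i j e)

enumeration⇒card : ∀ {A : Set} {_~_ : A → A → Set} {P : A → Set} {L : List A} →
  (∀ {a b} → a ~ b → b ~ a) → Enumeration _~_ P L → HasCard _~_ P (length L)
enumeration⇒card {L = L} sym~ e = record
  { elt      = lookup L
  ; elt-P    = λ i → All.lookup entries-P (∈-lookup i)
  ; elt-inj  = lookup-injective sym~ L distinct
  ; elt-surj = λ a pa → Any.index (complete a pa) , AnyP.lookup-index (complete a pa)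
  }
  where open Enumeration e

sum-cong : ∀ {A : Set} (xs : List A) {f g : A → ℕ} → (∀ a → f a ≡ g a) →
  sum (map f xs) ≡ sum (map g xs)
sum-cong xs f≗g = cong sum (map-cong f≗g xs)

sum-const : ∀ {A : Set} (xs : List A) {f : A → ℕ} (c : ℕ) → (∀ a → f a ≡ c) →
  sum (map f xs) ≡ length xs * c
sum-const []       c f≡c = refl
sum-const (x ∷ xs) c f≡c = cong₂ _+_ (f≡c x) (sum-const xs c f≡c)

length-concatMap : ∀ {A B : Set} (f : A → List B) xs →
  length (concatMap f xs) ≡ sum (map (length ∘ f) xs)
length-concatMap f []       = refl
length-concatMap f (x ∷ xs) = trans (length-++ (f x)) (cong (length (f x) +_) (length-concatMap f xs))

sum-allFin-suc : ∀ n (h : Fin (suc n) → ℕ) →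
  sum (map h (allFin (suc n))) ≡ h zero + sum (map (h ∘ suc) (allFin n))
sum-allFin-suc n h = cong (λ l → h zero + sum l)
  (trans (map-tabulate suc h) (sym (map-tabulate id (h ∘ suc))))

sum-exchange : ∀ n (x₀ : Fin n) (f g : Fin n → ℕ) → (∀ x → x ≢ x₀ → f x ≡ g x) →
  sum (map f (allFin n)) + g x₀ ≡ sum (map g (allFin n)) + f x₀
sum-exchange (suc n) zero f g agree
  rewrite sum-allFin-suc n f | sum-allFin-suc n g
        | sum-cong (allFin n) {f ∘ suc} {g ∘ suc} (λ i → agree (suc i) λ ())
  = solve (f zero) (g zero) (sum (map (g ∘ suc) (allFin n)))
  where
  solve : ∀ a b S → (a + S) + b ≡ (b + S) + a
  solve = solve-∀
sum-exchange (suc n) (suc x₀) f g agree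
  rewrite sum-allFin-suc n f | sum-allFin-suc n g | agree zero (λ ())
  = begin
      (g zero + Σf) + g (suc x₀)  ≡⟨ +-assoc (g zero) Σf _ ⟩
      g zero + (Σf + g (suc x₀))  ≡⟨ cong (g zero +_) (sum-exchange n x₀ (f ∘ suc) (g ∘ suc)
                                                         (λ x x≢ → agree (suc x) (x≢ ∘ suc-injective))) ⟩
      g zero + (Σg + f (suc x₀))  ≡⟨ +-assoc (g zero) Σg _ ⟨
      (g zero + Σg) + f (suc x₀)  ∎
  where
  open ≡-Reasoning
  Σf = sum (map (f ∘ suc) (allFin n))
  Σg = sum (map (g ∘ suc) (allFin n))

-- Parity, as a homomorphism (ℕ, +) → (Bool, xor).

parity : ℕ → Bool
parity zero    = false
parity (suc m) = not (parity m)

parity-+ : ∀ m n → parity (m + n) ≡ parity m xor parity n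
parity-+ zero    n = refl
parity-+ (suc m) n = trans (cong not (parity-+ m n)) (not-distribˡ-xor (parity m) (parity n))

parity-false⇒even : ∀ m → parity m ≡ false → 2 ∣ m
parity-false⇒even zero          _ = divides 0 refl
parity-false⇒even (suc zero)    ()
parity-false⇒even (suc (suc m)) p with parity-false⇒even m (trans (sym (not-involutive (parity m))) p)
... | divides q m≡q*2 = divides (suc q) (cong (λ k → suc (suc k)) m≡q*2)

even⇒parity-false : ∀ m → 2 ∣ m → parity m ≡ false
even⇒parity-false m (divides q refl) = parity-double q
  where
  parity-double : ∀ q → parity (q * 2) ≡ false
  parity-double zero    = refl
  parity-double (suc q) = trans (not-involutive (parity (q * 2))) (parity-double q)

xor-telescope : ∀ a b c → a xor c ≡ (a xor b) xor (b xor c)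
xor-telescope a b c = sym (begin
  (a xor b) xor (b xor c)  ≡⟨ xor-assoc a b (b xor c) ⟩
  a xor (b xor (b xor c))  ≡⟨ cong (a xor_) (xor-assoc b b c) ⟨
  a xor ((b xor b) xor c)  ≡⟨ cong (λ z → a xor (z xor c)) (xor-same b) ⟩
  a xor c                  ∎)
  where open ≡-Reasoning

xor-transpose : ∀ a b c d → a xor c ≡ b xor d → a xor b ≡ d xor c
xor-transpose false false c d refl = sym (xor-same c)
xor-transpose false true  c d refl = sym (xor-inverseʳ d)
xor-transpose true  false c d refl = sym (xor-inverseˡ c)
xor-transpose true  true  c d e with not-injective e
... | refl = sym (xor-same c)

parity-change₁ : ∀ n (x₀ : Fin n) (f g : Fin n → ℕ) → (∀ x → x ≢ x₀ → f x ≡ g x) →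
  parity (sum (map f (allFin n))) xor parity (sum (map g (allFin n)))
    ≡ parity (f x₀) xor parity (g x₀)
parity-change₁ n x₀ f g agree =
  xor-transpose (parity Σf) (parity Σg) (parity (g x₀)) (parity (f x₀)) (begin
      parity Σf xor parity (g x₀)   ≡⟨ parity-+ Σf (g x₀) ⟨
      parity (Σf + g x₀)            ≡⟨ cong parity (sum-exchange n x₀ f g agree) ⟩
      parity (Σg + f x₀)            ≡⟨ parity-+ Σg (f x₀) ⟩
      parity Σg xor parity (f x₀)   ∎)
  where
  open ≡-Reasoning
  Σf = sum (map f (allFin n))
  Σg = sum (map g (allFin n))

-- Changing a sum at two points p ≢ q: pass through the function h that
-- already agrees with g at p and with f elsewhere.
parity-change₂ : ∀ n (p q : Fin n) → p ≢ q → (f g : Fin n → ℕ) → (∀ x → x ≢ p → x ≢ q → f x ≡ g x) →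
  parity (sum (map f (allFin n))) xor parity (sum (map g (allFin n)))
    ≡ (parity (f p) xor parity (g p)) xor (parity (f q) xor parity (g q))
parity-change₂ n p q p≢q f g agree =
  trans (xor-telescope (parity (sum (map f (allFin n)))) (parity (sum (map h (allFin n)))) (parity (sum (map g (allFin n)))))
    (cong₂ _xor_
      (trans (parity-change₁ n p f h (λ x x≢p → sym (h≡f x x≢p))) (cong (λ z → parity (f p) xor parity z) h≡g-at-p))
      (trans (parity-change₁ n q h g h≡g-off-q) (cong (λ z → parity z xor parity (g q)) (h≡f q (p≢q ∘ sym)))))
  where
  h : Fin n → ℕ
  h x = if does (x ≟ p) then g x else f x
  h≡f : ∀ x → x ≢ p → h x ≡ f x
  h≡f x x≢p with x ≟ p
  ... | yes x≡p = ⊥-elim (x≢p x≡p)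
  ... | no  _   = refl
  h≡g-at-p : h p ≡ g p
  h≡g-at-p with p ≟ p
  ... | yes _   = refl
  ... | no  p≢p = ⊥-elim (p≢p refl)
  h≡g-off-q : ∀ x → x ≢ q → h x ≡ g x
  h≡g-off-q x x≢q with x ≟ p
  ... | yes _   = refl
  ... | no  x≢p = agree x x≢p x≢q

𝟙 : Bool → ℕ
𝟙 b = if b then 1 else 0

<?-isYes : ∀ {n} (i j : Fin n) → ⌊ i <? j ⌋ ≡ (toℕ i <ᵇ toℕ j)
<?-isYes i j = isYes≗does (i <? j)

<ᵇ-true : ∀ m n → m < n → (m <ᵇ n) ≡ true
<ᵇ-true zero    (suc n) _         = refl
<ᵇ-true (suc m) (suc n) (s≤s m<n) = <ᵇ-true m n m<n

<ᵇ-false : ∀ m n → n ≤ m → (m <ᵇ n) ≡ false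
<ᵇ-false m       zero    _         = refl
<ᵇ-false (suc m) (suc n) (s≤s n≤m) = <ᵇ-false m n n≤m

-- punchIn v : Fin n → Fin (n+1) is monotone, so it preserves comparisons among
-- its values and with every threshold on the correct side of v.
punchIn-<ᵇ : ∀ {n} (v : Fin (suc n)) (a b : Fin n) →
  (toℕ (punchIn v a) <ᵇ toℕ (punchIn v b)) ≡ (toℕ a <ᵇ toℕ b)
punchIn-<ᵇ zero    a       b       = refl
punchIn-<ᵇ (suc v) zero    zero    = refl
punchIn-<ᵇ (suc v) zero    (suc b) = refl
punchIn-<ᵇ (suc v) (suc a) zero    = refl
punchIn-<ᵇ (suc v) (suc a) (suc b) = punchIn-<ᵇ v a b

punchIn-<ᵇ-below : ∀ {n} (v : Fin (suc n)) (w : Fin n) k → k ≤ toℕ v →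
  (toℕ (punchIn v w) <ᵇ k) ≡ (toℕ w <ᵇ k)
punchIn-<ᵇ-below v       w       zero    _         = refl
punchIn-<ᵇ-below (suc v) zero    (suc k) _         = refl
punchIn-<ᵇ-below (suc v) (suc w) (suc k) (s≤s k≤v) = punchIn-<ᵇ-below v w k k≤v

punchIn-<ᵇ-above : ∀ {n} (v : Fin (suc n)) (w : Fin n) k → toℕ v ≤ k →
  (toℕ (punchIn v w) <ᵇ suc k) ≡ (toℕ w <ᵇ k)
punchIn-<ᵇ-above zero    w       k       _         = refl
punchIn-<ᵇ-above (suc v) zero    (suc k) _         = refl
punchIn-<ᵇ-above (suc v) (suc w) (suc k) (s≤s v≤k) = punchIn-<ᵇ-above v w k v≤k

prepend : ∀ {n} → Fin (suc n) → Perm n → Perm (suc n)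
prepend v τ zero    = v
prepend v τ (suc i) = punchIn v (τ i)

prepend-injective : ∀ {n} (v : Fin (suc n)) (τ : Perm n) → Injective _≡_ _≡_ τ → Injective _≡_ _≡_ (prepend v τ)
prepend-injective v τ inj {zero}  {zero}  e = refl
prepend-injective v τ inj {zero}  {suc y} e = ⊥-elim (punchInᵢ≢i v (τ y) (sym e))
prepend-injective v τ inj {suc x} {zero}  e = ⊥-elim (punchInᵢ≢i v (τ x) e)
prepend-injective v τ inj {suc x} {suc y} e = cong suc (inj (punchIn-injective v _ _ e))

prepend-surjective : ∀ {n} (v : Fin (suc n)) (τ : Perm n) → Surjective _≡_ _≡_ τ → Surjective _≡_ _≡_ (prepend v τ)
prepend-surjective v τ sur y with v ≟ y
... | yes refl = zero , λ { refl → refl }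
... | no  v≢y with sur (punchOut v≢y)
...   | x , hx = suc x , λ { refl → trans (cong (punchIn v) (hx refl)) (punchIn-punchOut v≢y) }

countBelow : ∀ {n} → Perm n → ℕ → ℕ
countBelow {n} τ k = sum (map (λ j → 𝟙 (toℕ (τ j) <ᵇ k)) (allFin n))

CountsBelow : ∀ {n} → Perm n → Set
CountsBelow {n} τ = ∀ k → k ≤ n → countBelow τ k ≡ k

prepend-countsBelow : ∀ {n} (v : Fin (suc n)) (τ : Perm n) → CountsBelow τ → CountsBelow (prepend v τ)
prepend-countsBelow {n} v τ count k k≤ with toℕ v ℕₚ.<? k
prepend-countsBelow {n} v τ count (suc k) k≤ | yes (s≤s v≤k) =
  trans (sum-allFin-suc n _)
    (cong₂ _+_ (cong 𝟙 (<ᵇ-true (toℕ v) (suc k) (s≤s v≤k)))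
      (trans (sum-cong (allFin n) (λ j → cong 𝟙 (punchIn-<ᵇ-above v (τ j) k v≤k)))
        (count k (≤-pred k≤))))
... | no v≮k =
  trans (sum-allFin-suc n _)
    (cong₂ _+_ (cong 𝟙 (<ᵇ-false (toℕ v) k (≮⇒≥ v≮k)))
      (trans (sum-cong (allFin n) (λ j → cong 𝟙 (punchIn-<ᵇ-below v (τ j) k (≮⇒≥ v≮k))))
        (count k (≤-trans (≮⇒≥ v≮k) (≤-pred (toℕ<n v))))))

IsPerm : ∀ {n} → Perm n → Set
IsPerm τ = Bijective _≡_ _≡_ τ × CountsBelow τ

prepend-isPerm : ∀ {n} (v : Fin (suc n)) (τ : Perm n) → IsPerm τ → IsPerm (prepend v τ)
prepend-isPerm v τ ((inj , sur) , count) =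
  (prepend-injective v τ inj , prepend-surjective v τ sur) , prepend-countsBelow v τ count

inversion-entry : ∀ {n} → Perm n → Fin n → Fin n → ℕ
inversion-entry σ i j = if ⌊ i <? j ⌋ ∧ ⌊ σ j <? σ i ⌋ then 1 else 0

inversion-entry-ℕ : ∀ {n} (σ : Perm n) i j →
  inversion-entry σ i j ≡ 𝟙 ((toℕ i <ᵇ toℕ j) ∧ (toℕ (σ j) <ᵇ toℕ (σ i)))
inversion-entry-ℕ σ i j = cong₂ (λ a b → 𝟙 (a ∧ b)) (<?-isYes i j) (<?-isYes (σ j) (σ i))

inversions-cong : ∀ {n} {σ σ' : Perm n} → σ ≗ σ' → inversions σ ≡ inversions σ'
inversions-cong {n} {σ} {σ'} σ≗σ' = sum-cong (allFin n) (λ i → sum-cong (allFin n) (λ j →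
  cong₂ (λ a b → if ⌊ i <? j ⌋ ∧ ⌊ a <? b ⌋ then 1 else 0) (σ≗σ' j) (σ≗σ' i)))

-- Row 0 of prepend v τ contributes the v points mapped below v; the other rows
-- reproduce the inversions of τ.
inversions-prepend : ∀ {n} (v : Fin (suc n)) (τ : Perm n) → CountsBelow τ →
  inversions (prepend v τ) ≡ toℕ v + inversions τ
inversions-prepend {n} v τ count = trans (sum-allFin-suc n _) (cong₂ _+_ row₀ rows)
  where
  σ = prepend v τ
  row₀ : sum (map (inversion-entry σ zero) (allFin (suc n))) ≡ toℕ v
  row₀ = trans (sum-allFin-suc n (inversion-entry σ zero))
    (trans (cong₂ _+_ (inversion-entry-ℕ σ zero zero)
       (sum-cong (allFin n) (λ j → trans (inversion-entry-ℕ σ zero (suc j))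
          (cong 𝟙 (punchIn-<ᵇ-below v (τ j) (toℕ v) ≤-refl)))))
      (count (toℕ v) (≤-pred (toℕ<n v))))
  rows : sum (map (λ i → sum (map (inversion-entry σ (suc i)) (allFin (suc n)))) (allFin n)) ≡ inversions τ
  rows = sum-cong (allFin n) (λ i → trans (sum-allFin-suc n (inversion-entry σ (suc i)))
    (cong₂ _+_ (inversion-entry-ℕ σ (suc i) zero)
      (sum-cong (allFin n) (λ j →
        begin
          inversion-entry σ (suc i) (suc j)
        ≡⟨ inversion-entry-ℕ σ (suc i) (suc j) ⟩
          𝟙 ((toℕ i <ᵇ toℕ j) ∧ (toℕ (punchIn v (τ j)) <ᵇ toℕ (punchIn v (τ i))))
        ≡⟨ cong (λ b → 𝟙 ((toℕ i <ᵇ toℕ j) ∧ b)) (punchIn-<ᵇ v (τ j) (τ i)) ⟩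
          𝟙 ((toℕ i <ᵇ toℕ j) ∧ (toℕ (τ j) <ᵇ toℕ (τ i)))
        ≡⟨ inversion-entry-ℕ τ i j ⟨
          inversion-entry τ i j
        ∎))))
    where open ≡-Reasoning

-- The permutations of Fin n with inversion parity b, listed by recursion on n:
-- σ is determined by v = σ 0 and a permutation of n points of parity b xor parity v.
permsOfParity : (n : ℕ) → Bool → List (Perm n)
permsOfParity zero    false = id ∷ []
permsOfParity zero    true  = []
permsOfParity (suc n) b     =
  concatMap (λ v → map (prepend v) (permsOfParity n (b xor parity (toℕ v)))) (allFin (suc n))

all-permsOfParity-suc : ∀ {Q : ∀ {m} → Perm m → Set} n b →
  (∀ v → All (Q ∘ prepend v) (permsOfParity n (b xor parity (toℕ v)))) → All Q (permsOfParity (suc n) b)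
all-permsOfParity-suc n b h = AllP.concat⁺ (AllP.map⁺ (AllP.tabulate⁺ (λ v → AllP.map⁺ (h v))))

permsOfParity-isPerm : ∀ n b → All IsPerm (permsOfParity n b)
permsOfParity-isPerm zero    false = (((λ {x} → ⊥-elim (fin0 x)) , λ y → ⊥-elim (fin0 y)) , λ { zero z≤n → refl }) ∷ []
  where
  fin0 : Fin 0 → ⊥
  fin0 ()
permsOfParity-isPerm zero    true  = []
permsOfParity-isPerm (suc n) b     =
  all-permsOfParity-suc {IsPerm} n b (λ v → All.map (prepend-isPerm v _) (permsOfParity-isPerm n _))

xor-cancel-middle : ∀ a b → a xor (b xor a) ≡ b
xor-cancel-middle false b = xor-identityʳ b
xor-cancel-middle true  b = trans (cong not (xor-comm b true)) (not-involutive b)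

permsOfParity-parity : ∀ n b → All (λ σ → parity (inversions σ) ≡ b) (permsOfParity n b)
permsOfParity-parity zero    false = refl ∷ []
permsOfParity-parity zero    true  = []
permsOfParity-parity (suc n) b     = all-permsOfParity-suc {λ σ → parity (inversions σ) ≡ b} n b (λ v →
  All.zipWith (λ { {τ} (τ-perm , τ-par) →
      begin
        parity (inversions (prepend v τ))             ≡⟨ cong parity (inversions-prepend v τ (proj₂ τ-perm)) ⟩
        parity (toℕ v + inversions τ)                 ≡⟨ parity-+ (toℕ v) (inversions τ) ⟩
        parity (toℕ v) xor parity (inversions τ)      ≡⟨ cong (parity (toℕ v) xor_) τ-par ⟩
        parity (toℕ v) xor (b xor parity (toℕ v))     ≡⟨ xor-cancel-middle (parity (toℕ v)) b ⟩
        b                                             ∎ })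
    (permsOfParity-isPerm n _ , permsOfParity-parity n _))
  where open ≡-Reasoning

module Decompose {n} (σ : Perm (suc n)) (inj : Injective _≡_ _≡_ σ) where
  rest : Perm n
  rest i = punchOut {i = σ zero} {j = σ (suc i)} (λ e → zero≢suc (inj e))
    where
    zero≢suc : ∀ {m} {i : Fin m} → Fin.zero ≢ suc i
    zero≢suc ()

  σ≗prepend : σ ≗ prepend (σ zero) rest
  σ≗prepend zero    = refl
  σ≗prepend (suc i) = sym (punchIn-punchOut _)

  rest-bijective : Surjective _≡_ _≡_ σ → Bijective _≡_ _≡_ rest
  rest-bijective sur = rest-inj , rest-sur
    where
    rest-inj : Injective _≡_ _≡_ rest
    rest-inj {x} {y} e = suc-injective (inj (punchOut-injective {i = σ zero} {j = σ (suc x)} {k = σ (suc y)} _ _ e))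
    rest-sur : Surjective _≡_ _≡_ rest
    rest-sur w with sur (punchIn (σ zero) w)
    ... | zero  , h = ⊥-elim (punchInᵢ≢i (σ zero) w (sym (h refl)))
    ... | suc x , h = x , λ { refl → trans (punchOut-cong (σ zero) (h refl)) (punchOut-punchIn (σ zero)) }

prepend-cong : ∀ {n} (v : Fin (suc n)) {τ τ' : Perm n} → τ ≗ τ' → prepend v τ ≗ prepend v τ'
prepend-cong v τ≗τ' zero    = refl
prepend-cong v τ≗τ' (suc i) = cong (punchIn v) (τ≗τ' i)

-- Every bijection occurs (up to ≗) in the list of its own parity: its rest τ
-- occurs, as some τ₀, in the list for parity(σ) xor parity(σ 0).
permsOfParity-complete : ∀ n (σ : Perm n) → Bijective _≡_ _≡_ σ →
  Any (σ ≗_) (permsOfParity n (parity (inversions σ)))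
permsOfParity-complete zero    σ _           = here (λ ())
permsOfParity-complete (suc n) σ (inj , sur) =
  AnyP.concat⁺ (AnyP.map⁺ (AnyP.tabulate⁺ {f = id} v (AnyP.map⁺ {f = prepend v}
    (Any.map (λ τ≗τ₁ i → trans (σ≗prepend i) (prepend-cong v τ≗τ₁ i))
      (subst (λ b → Any (τ ≗_) (permsOfParity n b)) τ-parity τ-found)))))
  where
  open ≡-Reasoning
  open Decompose σ inj
  v = σ zero
  τ = rest
  τ-found = permsOfParity-complete n τ (rest-bijective sur)
  -- the listed copy τ₀ of τ is a permutation, so the prepend formula applies
  τ₀ = Any.lookup τ-found
  τ₀-perm : IsPerm τ₀
  τ₀-perm = proj₁ (All.lookupAny (permsOfParity-isPerm n _) τ-found)
  τ≗τ₀ : τ ≗ τ₀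
  τ≗τ₀ = proj₂ (All.lookupAny (permsOfParity-isPerm n _) τ-found)
  σ-parity : parity (inversions σ) ≡ parity (toℕ v) xor parity (inversions τ)
  σ-parity = begin
    parity (inversions σ)                      ≡⟨ cong parity (inversions-cong (λ i → trans (σ≗prepend i) (prepend-cong v τ≗τ₀ i))) ⟩
    parity (inversions (prepend v τ₀))         ≡⟨ cong parity (inversions-prepend v τ₀ (proj₂ τ₀-perm)) ⟩
    parity (toℕ v + inversions τ₀)             ≡⟨ cong (λ i → parity (toℕ v + i)) (inversions-cong τ≗τ₀) ⟨
    parity (toℕ v + inversions τ)              ≡⟨ parity-+ (toℕ v) (inversions τ) ⟩
    parity (toℕ v) xor parity (inversions τ)   ∎
  τ-parity : parity (inversions τ) ≡ parity (inversions σ) xor parity (toℕ v)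
  τ-parity = sym (begin
    parity (inversions σ) xor parity (toℕ v)                       ≡⟨ cong (_xor parity (toℕ v)) σ-parity ⟩
    (parity (toℕ v) xor parity (inversions τ)) xor parity (toℕ v)  ≡⟨ xor-assoc (parity (toℕ v)) (parity (inversions τ)) _ ⟩
    parity (toℕ v) xor (parity (inversions τ) xor parity (toℕ v))  ≡⟨ xor-cancel-middle (parity (toℕ v)) (parity (inversions τ)) ⟩
    parity (inversions τ)                                          ∎)

-- Distinct first values, or distinct tails, give distinct permutations.
permsOfParity-distinct : ∀ n b → AllPairs (λ σ σ' → ¬ σ ≗ σ') (permsOfParity n b)
permsOfParity-distinct zero    false = [] ∷ []
permsOfParity-distinct zero    true  = []
permsOfParity-distinct (suc n) b     = AllPairsP.concat⁺
  (AllP.map⁺ (AllP.tabulate⁺ (λ v → AllPairsP.map⁺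
    (AllPairs.map (λ τ≉τ' e → τ≉τ' (λ i → punchIn-injective v _ _ (e (suc i)))) (permsOfParity-distinct n _)))))
  (AllPairsP.map⁺ (AllPairsP.tabulate⁺ {f = id} (λ {v} {v'} v≢v' →
     AllP.map⁺ (All.universal (λ _ → AllP.map⁺ (All.universal (λ _ e → v≢v' (e zero)) _)) _))))

permsOfParity-length : ∀ m b → length (permsOfParity (suc (suc m)) b) * 2 ≡ (suc (suc m)) !
permsOfParity-length zero    false = refl
permsOfParity-length zero    true  = refl
permsOfParity-length (suc m) b     =
  begin
    length (permsOfParity (3 + m) b) * 2
  ≡⟨ cong (_* 2) (trans (length-concatMap (λ v → map (prepend v) (permsOfParity (2 + m) (b xor parity (toℕ v)))) (allFin (3 + m)))
        (sum-const (allFin (3 + m)) c (λ v → trans (length-map (prepend v) (permsOfParity (2 + m) (b xor parity (toℕ v)))) (independent (b xor parity (toℕ v)))))) ⟩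
    (length (allFin (3 + m)) * c) * 2
  ≡⟨ cong (λ k → (k * c) * 2) (length-tabulate {n = 3 + m} id) ⟩
    ((3 + m) * c) * 2
  ≡⟨ *-assoc (3 + m) c 2 ⟩
    (3 + m) * (c * 2)
  ≡⟨ cong ((3 + m) *_) (permsOfParity-length m false) ⟩
    (3 + m) !
  ∎
  where
  open ≡-Reasoning
  c = length (permsOfParity (2 + m) false)
  independent : ∀ b' → length (permsOfParity (2 + m) b') ≡ c
  independent b' = *-cancelʳ-≡ _ _ 2 (trans (permsOfParity-length m b') (sym (permsOfParity-length m false)))

swap : ∀ {n} → Fin n → Fin n → Perm n
swap a b i with i ≟ a
... | yes _ = b
... | no  _ with i ≟ b
...   | yes _ = a
...   | no  _ = i

swap-a : ∀ {n} (a b : Fin n) → swap a b a ≡ b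
swap-a a b with a ≟ a
... | yes _   = refl
... | no  a≢a = ⊥-elim (a≢a refl)

swap-b : ∀ {n} (a b : Fin n) → swap a b b ≡ a
swap-b a b with b ≟ a
... | yes b≡a = b≡a
... | no  _ with b ≟ b
...   | yes _   = refl
...   | no  b≢b = ⊥-elim (b≢b refl)

swap-other : ∀ {n} (a b i : Fin n) → i ≢ a → i ≢ b → swap a b i ≡ i
swap-other a b i i≢a i≢b with i ≟ a
... | yes i≡a = ⊥-elim (i≢a i≡a)
... | no  _ with i ≟ b
...   | yes i≡b = ⊥-elim (i≢b i≡b)
...   | no  _   = refl

swap-involutive : ∀ {n} (a b : Fin n) i → swap a b (swap a b i) ≡ i
swap-involutive a b i with i ≟ a
... | yes refl = swap-b i b
... | no  i≢a with i ≟ b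
...   | yes refl = swap-a a i
...   | no  i≢b  = swap-other a b i i≢a i≢b

cycle-a : ∀ {n} (a b c : Fin n) → cyc3 a b c a ≡ b
cycle-a a b c with a ≟ a
... | yes _   = refl
... | no  a≢a = ⊥-elim (a≢a refl)

cycle-b : ∀ {n} (a b c : Fin n) → b ≢ a → cyc3 a b c b ≡ c
cycle-b a b c b≢a with b ≟ a
... | yes b≡a = ⊥-elim (b≢a b≡a)
... | no  _ with b ≟ b
...   | yes _   = refl
...   | no  b≢b = ⊥-elim (b≢b refl)

cycle-c : ∀ {n} (a b c : Fin n) → c ≢ a → c ≢ b → cyc3 a b c c ≡ a
cycle-c a b c c≢a c≢b with c ≟ a
... | yes c≡a = ⊥-elim (c≢a c≡a)
... | no  _ with c ≟ b
...   | yes c≡b = ⊥-elim (c≢b c≡b)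
...   | no  _ with c ≟ c
...     | yes _   = refl
...     | no  c≢c = ⊥-elim (c≢c refl)

cycle-other : ∀ {n} (a b c i : Fin n) → i ≢ a → i ≢ b → i ≢ c → cyc3 a b c i ≡ i
cycle-other a b c i i≢a i≢b i≢c with i ≟ a
... | yes i≡a = ⊥-elim (i≢a i≡a)
... | no  _ with i ≟ b
...   | yes i≡b = ⊥-elim (i≢b i≡b)
...   | no  _ with i ≟ c
...     | yes i≡c = ⊥-elim (i≢c i≡c)
...     | no  _   = refl

by-cases : ∀ {n} (i a : Fin n) {P : Set} → (i ≡ a → P) → (i ≢ a → P) → P
by-cases i a if-eq if-ne with i ≟ a
... | yes i≡a = if-eq i≡a
... | no  i≢a = if-ne i≢a

cycle≗swaps : ∀ {n} (a b c : Fin n) → a ≢ b → a ≢ c → b ≢ c → cyc3 a b c ≗ swap a b ∘ swap b c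
cycle≗swaps a b c a≢b a≢c b≢c i =
  by-cases i a (λ { refl → trans (cycle-a i b c) (sym (trans (cong (swap i b) (swap-other b c i a≢b a≢c)) (swap-a i b))) })
  (λ i≢a → by-cases i b (λ { refl → trans (cycle-b a i c (≢-sym a≢b))
      (sym (trans (cong (swap a i) (swap-a i c)) (swap-other a i c (≢-sym a≢c) (≢-sym b≢c)))) })
  (λ i≢b → by-cases i c (λ { refl → trans (cycle-c a b i (≢-sym a≢c) (≢-sym b≢c))
      (sym (trans (cong (swap a b) (swap-b b i)) (swap-b a b))) })
  (λ i≢c → trans (cycle-other a b c i i≢a i≢b i≢c)
      (sym (trans (cong (swap a b) (swap-other b c i i≢b i≢c)) (swap-other a b i i≢a i≢b))))))

cycle≗conjugate : ∀ {n} (a b c c' : Fin n) → a ≢ b → a ≢ c → a ≢ c' → b ≢ c → b ≢ c' → c ≢ c' →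
  cyc3 a b c' ≗ swap c c' ∘ cyc3 a b c ∘ swap c c'
cycle≗conjugate a b c c' a≢b a≢c a≢c' b≢c b≢c' c≢c' i =
  by-cases i a (λ { refl → trans (cycle-a i b c') (sym (trans (cong (swap c c' ∘ cyc3 i b c) (swap-other c c' i a≢c a≢c'))
      (trans (cong (swap c c') (cycle-a i b c)) (swap-other c c' b b≢c b≢c')))) })
  (λ i≢a → by-cases i b (λ { refl → trans (cycle-b a i c' (≢-sym a≢b)) (sym (trans (cong (swap c c' ∘ cyc3 a i c) (swap-other c c' i b≢c b≢c'))
      (trans (cong (swap c c') (cycle-b a i c (≢-sym a≢b))) (swap-a c c')))) })
  (λ i≢b → by-cases i c (λ { refl → trans (cycle-other a b c' i (≢-sym a≢c) (≢-sym b≢c) c≢c')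
      (sym (trans (cong (swap i c' ∘ cyc3 a b i) (swap-a i c'))
      (trans (cong (swap i c') (cycle-other a b i c' (≢-sym a≢c') (≢-sym b≢c') (≢-sym c≢c'))) (swap-b i c')))) })
  (λ i≢c → by-cases i c' (λ { refl → trans (cycle-c a b i (≢-sym a≢c') (≢-sym b≢c'))
      (sym (trans (cong (swap c i ∘ cyc3 a b c) (swap-b c i))
      (trans (cong (swap c i) (cycle-c a b c (≢-sym a≢c) (≢-sym b≢c))) (swap-other c i a a≢c a≢c')))) })
  (λ i≢c' → trans (cycle-other a b c' i i≢a i≢b i≢c') (sym (trans (cong (swap c c' ∘ cyc3 a b c) (swap-other c c' i i≢c i≢c'))
      (trans (cong (swap c c') (cycle-other a b c i i≢a i≢b i≢c)) (swap-other c c' i i≢c i≢c'))))))))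

cycle-cubed : ∀ {n} (a b c : Fin n) → a ≢ b → a ≢ c → b ≢ c → ∀ i → cyc3 a b c (cyc3 a b c (cyc3 a b c i)) ≡ i
cycle-cubed a b c a≢b a≢c b≢c i =
  by-cases i a (λ { refl → trans (cong (λ z → cyc3 i b c (cyc3 i b c z)) (cycle-a i b c))
      (trans (cong (cyc3 i b c) (cycle-b i b c (≢-sym a≢b))) (cycle-c i b c (≢-sym a≢c) (≢-sym b≢c))) })
  (λ i≢a → by-cases i b (λ { refl → trans (cong (λ z → cyc3 a i c (cyc3 a i c z)) (cycle-b a i c (≢-sym a≢b)))
      (trans (cong (cyc3 a i c) (cycle-c a i c (≢-sym a≢c) (≢-sym b≢c))) (cycle-a a i c)) })
  (λ i≢b → by-cases i c (λ { refl → trans (cong (λ z → cyc3 a b i (cyc3 a b i z)) (cycle-c a b i (≢-sym a≢c) (≢-sym b≢c)))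
      (trans (cong (cyc3 a b i) (cycle-a a b i)) (cycle-b a b i (≢-sym a≢b))) })
  (λ i≢c → trans (cong (λ z → cyc3 a b c (cyc3 a b c z)) (cycle-other a b c i i≢a i≢b i≢c))
      (trans (cong (cyc3 a b c) (cycle-other a b c i i≢a i≢b i≢c)) (cycle-other a b c i i≢a i≢b i≢c)))))

bijective-∘ : ∀ {n} {f g : Perm n} → Bijective _≡_ _≡_ f → Bijective _≡_ _≡_ g → Bijective _≡_ _≡_ (f ∘ g)
bijective-∘ {f = f} {g} (f-inj , f-sur) (g-inj , g-sur) = (λ e → g-inj (f-inj e)) , sur
  where
  sur : Surjective _≡_ _≡_ (f ∘ g)
  sur y with f-sur y
  ... | x , hx with g-sur x
  ...   | z , hz = z , λ { refl → hx (hz refl) }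

bijective-≗ : ∀ {n} {f g : Perm n} → f ≗ g → Bijective _≡_ _≡_ f → Bijective _≡_ _≡_ g
bijective-≗ {f = f} {g} f≗g (f-inj , f-sur) = (λ {x} {y} e → f-inj (trans (f≗g x) (trans e (sym (f≗g y))))) , sur
  where
  sur : Surjective _≡_ _≡_ g
  sur y with f-sur y
  ... | x , hx = x , λ { refl → trans (sym (f≗g x)) (hx refl) }

swap-bijective : ∀ {n} (a b : Fin n) → Bijective _≡_ _≡_ (swap a b)
swap-bijective a b =
  (λ {x} {y} e → trans (sym (swap-involutive a b x)) (trans (cong (swap a b) e) (swap-involutive a b y)))
  , λ y → swap a b y , λ { refl → swap-involutive a b y }

cycle-bijective : ∀ {n} (a b c : Fin n) → a ≢ b → a ≢ c → b ≢ c → Bijective _≡_ _≡_ (cyc3 a b c)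
cycle-bijective a b c a≢b a≢c b≢c =
  bijective-≗ (λ i → sym (cycle≗swaps a b c a≢b a≢c b≢c i)) (bijective-∘ (swap-bijective a b) (swap-bijective b c))

-- An adjacent transposition (a a+1), applied after σ, flips the inversion parity.

<ᵇ-irrefl : ∀ m → (m <ᵇ m) ≡ false
<ᵇ-irrefl m = <ᵇ-false m m ≤-refl

<ᵇ-suc-threshold : ∀ l k → l ≢ k → (l <ᵇ suc k) ≡ (l <ᵇ k)
<ᵇ-suc-threshold zero    zero    l≢k = ⊥-elim (l≢k refl)
<ᵇ-suc-threshold zero    (suc k) l≢k = refl
<ᵇ-suc-threshold (suc l) zero    l≢k = <ᵇ-false l 0 z≤n
<ᵇ-suc-threshold (suc l) (suc k) l≢k = <ᵇ-suc-threshold l k (l≢k ∘ cong suc)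

<ᵇ-suc-left : ∀ k l → l ≢ suc k → (suc k <ᵇ l) ≡ (k <ᵇ l)
<ᵇ-suc-left k       zero          l≢ = sym (<ᵇ-false k 0 z≤n)
<ᵇ-suc-left zero    (suc zero)    l≢ = ⊥-elim (l≢ refl)
<ᵇ-suc-left zero    (suc (suc l)) l≢ = refl
<ᵇ-suc-left (suc k) (suc l)       l≢ = <ᵇ-suc-left k l (l≢ ∘ cong suc)

<ᵇ-trichotomy : ∀ x y → x ≢ y → (x <ᵇ y) xor (y <ᵇ x) ≡ true
<ᵇ-trichotomy zero    zero    x≢y = ⊥-elim (x≢y refl)
<ᵇ-trichotomy zero    (suc y) x≢y = refl
<ᵇ-trichotomy (suc x) zero    x≢y = refl
<ᵇ-trichotomy (suc x) (suc y) x≢y = <ᵇ-trichotomy x y (x≢y ∘ cong suc)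

parity-𝟙 : ∀ b → parity (𝟙 b) ≡ b
parity-𝟙 true  = refl
parity-𝟙 false = refl

xor-true⇒not : ∀ x y → x xor y ≡ true → x ≡ not y
xor-true⇒not true  false _ = refl
xor-true⇒not false true  _ = refl

inversion-entry-at : ∀ {n} (σ : Perm n) {i j x y} → σ i ≡ x → σ j ≡ y →
  inversion-entry σ i j ≡ 𝟙 ((toℕ i <ᵇ toℕ j) ∧ (toℕ y <ᵇ toℕ x))
inversion-entry-at σ {i} {j} refl refl = inversion-entry-ℕ σ i j

module AdjacentSwap {n} (a b : Fin n) (b≡a+1 : toℕ b ≡ suc (toℕ a)) where
  t : Perm n
  t = swap a b

  a≢b : a ≢ b
  a≢b a≡b = <-irrefl (trans (cong toℕ a≡b) b≡a+1) (n<1+n (toℕ a))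

  a<b : (toℕ a <ᵇ toℕ b) ≡ true
  a<b = trans (cong (toℕ a <ᵇ_) b≡a+1) (<ᵇ-true (toℕ a) (suc (toℕ a)) (n<1+n (toℕ a)))

  b≮a : (toℕ b <ᵇ toℕ a) ≡ false
  b≮a = <ᵇ-false (toℕ b) (toℕ a) (subst (toℕ a ≤_) (sym b≡a+1) (n≤1+n (toℕ a)))

  data SwapValue (x : Fin n) : Set where
    at-a  : x ≡ a → toℕ (t x) ≡ suc (toℕ a) → SwapValue x
    at-b  : x ≡ b → toℕ (t x) ≡ toℕ a → SwapValue x
    fixed : x ≢ a → x ≢ b → t x ≡ x → SwapValue x

  swapValue : ∀ x → SwapValue x
  swapValue x = by-cases x a (λ { refl → at-a refl (trans (cong toℕ (swap-a x b)) b≡a+1) })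
    (λ x≢a → by-cases x b (λ { refl → at-b refl (cong toℕ (swap-b a x)) })
    (λ x≢b → fixed x≢a x≢b (swap-other a b x x≢a x≢b)))

  toℕ-≢ : ∀ {x y : Fin n} → x ≢ y → toℕ x ≢ toℕ y
  toℕ-≢ x≢y e = x≢y (toℕ-injective e)

  t-preserves-order : ∀ u w → ¬ (u ≡ a × w ≡ b) → ¬ (u ≡ b × w ≡ a) →
    (toℕ (t w) <ᵇ toℕ (t u)) ≡ (toℕ w <ᵇ toℕ u)
  t-preserves-order u w not-ab not-ba with swapValue u | swapValue w
  ... | at-a refl _  | at-a refl _  = trans (<ᵇ-irrefl (toℕ (t a))) (sym (<ᵇ-irrefl (toℕ a)))
  ... | at-a refl _  | at-b refl _  = ⊥-elim (not-ab (refl , refl))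
  ... | at-a refl tu | fixed w≢a w≢b tw = trans (cong₂ _<ᵇ_ (cong toℕ tw) tu) (<ᵇ-suc-threshold (toℕ w) (toℕ a) (toℕ-≢ w≢a))
  ... | at-b refl _  | at-a refl _  = ⊥-elim (not-ba (refl , refl))
  ... | at-b refl _  | at-b refl _  = trans (<ᵇ-irrefl (toℕ (t b))) (sym (<ᵇ-irrefl (toℕ b)))
  ... | at-b refl tu | fixed w≢a w≢b tw = trans (cong₂ _<ᵇ_ (cong toℕ tw) tu)
        (trans (sym (<ᵇ-suc-threshold (toℕ w) (toℕ a) (toℕ-≢ w≢a))) (cong (toℕ w <ᵇ_) (sym b≡a+1)))
  ... | fixed u≢a u≢b tu | at-a refl tw = trans (cong₂ _<ᵇ_ tw (cong toℕ tu))
        (<ᵇ-suc-left (toℕ a) (toℕ u) (λ e → toℕ-≢ u≢b (trans e (sym b≡a+1))))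
  ... | fixed u≢a u≢b tu | at-b refl tw = trans (cong₂ _<ᵇ_ tw (cong toℕ tu))
        (trans (sym (<ᵇ-suc-left (toℕ a) (toℕ u) (λ e → toℕ-≢ u≢b (trans e (sym b≡a+1)))))
          (cong (_<ᵇ toℕ u) (sym b≡a+1)))
  ... | fixed u≢a u≢b tu | fixed w≢a w≢b tw = cong₂ _<ᵇ_ (cong toℕ tw) (cong toℕ tu)

  -- Only the two inversion entries at the positions p, q of the values a, b
  -- change, and exactly one of them is an inversion before and after.
  module _ (σ : Perm n) (σ-bij : Bijective _≡_ _≡_ σ) where
    private
      inj = proj₁ σ-bij
      p = proj₁ (proj₂ σ-bij a)
      q = proj₁ (proj₂ σ-bij b)
      σp≡a : σ p ≡ a
      σp≡a = proj₂ (proj₂ σ-bij a) refl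
      σq≡b : σ q ≡ b
      σq≡b = proj₂ (proj₂ σ-bij b) refl
      p≢q : p ≢ q
      p≢q p≡q = a≢b (trans (sym σp≡a) (trans (cong σ p≡q) σq≡b))
      F = inversion-entry (t ∘ σ)
      G = inversion-entry σ

      entries-agree : ∀ i j → ¬ (i ≡ p × j ≡ q) → ¬ (i ≡ q × j ≡ p) → F i j ≡ G i j
      entries-agree i j not-pq not-qp = begin
        F i j                                                      ≡⟨ inversion-entry-ℕ (t ∘ σ) i j ⟩
        𝟙 ((toℕ i <ᵇ toℕ j) ∧ (toℕ (t (σ j)) <ᵇ toℕ (t (σ i))))  ≡⟨ cong (λ z → 𝟙 ((toℕ i <ᵇ toℕ j) ∧ z))
                                                                      (t-preserves-order (σ i) (σ j) not-ab not-ba) ⟩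
        𝟙 ((toℕ i <ᵇ toℕ j) ∧ (toℕ (σ j) <ᵇ toℕ (σ i)))          ≡⟨ inversion-entry-ℕ σ i j ⟨
        G i j                                                      ∎
        where
        open ≡-Reasoning
        not-ab : ¬ (σ i ≡ a × σ j ≡ b)
        not-ab (e₁ , e₂) = not-pq (inj (trans e₁ (sym σp≡a)) , inj (trans e₂ (sym σq≡b)))
        not-ba : ¬ (σ i ≡ b × σ j ≡ a)
        not-ba (e₁ , e₂) = not-qp (inj (trans e₁ (sym σq≡b)) , inj (trans e₂ (sym σp≡a)))

      row : (Fin n → Fin n → ℕ) → Fin n → ℕ
      row E i = sum (map (E i) (allFin n))

      rows-agree : parity (inversions (t ∘ σ)) xor parity (inversions σ)
        ≡ (parity (row F p) xor parity (row G p)) xor (parity (row F q) xor parity (row G q))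
      rows-agree = parity-change₂ n p q p≢q (row F) (row G) (λ i i≢p i≢q → sum-cong (allFin n) (λ j →
        entries-agree i j (λ { (e , _) → i≢p e }) (λ { (e , _) → i≢q e })))

      row-p : parity (row F p) xor parity (row G p) ≡ parity (F p q) xor parity (G p q)
      row-p = parity-change₁ n q (F p) (G p) (λ j j≢q → entries-agree p j (λ { (_ , e) → j≢q e }) (λ { (e , _) → p≢q e }))

      row-q : parity (row F q) xor parity (row G q) ≡ parity (F q p) xor parity (G q p)
      row-q = parity-change₁ n p (F q) (G q) (λ j j≢p → entries-agree q j (λ { (e , _) → p≢q (sym e) }) (λ { (_ , e) → j≢p e }))

      tσp : t (σ p) ≡ b
      tσp = trans (cong t σp≡a) (swap-a a b)
      tσq : t (σ q) ≡ a
      tσq = trans (cong t σq≡b) (swap-b a b)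

      toggle : ∀ c d → ((c ∧ true) xor (c ∧ false)) xor ((d ∧ false) xor (d ∧ true)) ≡ c xor d
      toggle true  true  = refl
      toggle true  false = refl
      toggle false true  = refl
      toggle false false = refl

      c = toℕ p <ᵇ toℕ q
      d = toℕ q <ᵇ toℕ p

    flips-parity : parity (inversions (t ∘ σ)) ≡ not (parity (inversions σ))
    flips-parity = xor-true⇒not _ _ (begin
      parity (inversions (t ∘ σ)) xor parity (inversions σ)
        ≡⟨ rows-agree ⟩
      (parity (row F p) xor parity (row G p)) xor (parity (row F q) xor parity (row G q))
        ≡⟨ cong₂ _xor_ row-p row-q ⟩
      (parity (F p q) xor parity (G p q)) xor (parity (F q p) xor parity (G q p))
        ≡⟨ cong₂ _xor_ (cong₂ _xor_ (cong parity (inversion-entry-at (t ∘ σ) tσp tσq))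
                                    (cong parity (inversion-entry-at σ σp≡a σq≡b)))
                       (cong₂ _xor_ (cong parity (inversion-entry-at (t ∘ σ) tσq tσp))
                                    (cong parity (inversion-entry-at σ σq≡b σp≡a))) ⟩
      (parity (𝟙 (c ∧ (toℕ a <ᵇ toℕ b))) xor parity (𝟙 (c ∧ (toℕ b <ᵇ toℕ a))))
        xor (parity (𝟙 (d ∧ (toℕ b <ᵇ toℕ a))) xor parity (𝟙 (d ∧ (toℕ a <ᵇ toℕ b))))
        ≡⟨ cong₂ _xor_ (cong₂ _xor_ (parity-𝟙 (c ∧ (toℕ a <ᵇ toℕ b))) (parity-𝟙 (c ∧ (toℕ b <ᵇ toℕ a))))
                       (cong₂ _xor_ (parity-𝟙 (d ∧ (toℕ b <ᵇ toℕ a))) (parity-𝟙 (d ∧ (toℕ a <ᵇ toℕ b)))) ⟩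
      ((c ∧ (toℕ a <ᵇ toℕ b)) xor (c ∧ (toℕ b <ᵇ toℕ a))) xor ((d ∧ (toℕ b <ᵇ toℕ a)) xor (d ∧ (toℕ a <ᵇ toℕ b)))
        ≡⟨ cong₂ (λ A B → ((c ∧ A) xor (c ∧ B)) xor ((d ∧ B) xor (d ∧ A))) a<b b≮a ⟩
      ((c ∧ true) xor (c ∧ false)) xor ((d ∧ false) xor (d ∧ true))
        ≡⟨ toggle c d ⟩
      c xor d
        ≡⟨ <ᵇ-trichotomy (toℕ p) (toℕ q) (toℕ-≢ p≢q) ⟩
      true ∎)
      where open ≡-Reasoning

-- The generators (1 2 i) are even: left multiplication by the cycle (0 1 c),
-- c ≥ 2, preserves the inversion parity of a bijection, by induction on c:
-- (0 1 2) = (0 1)(1 2) and (0 1 c+1) = (c c+1)(0 1 c)(c c+1), products of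
-- an even number of adjacent swaps around (0 1 c).
cycle01-preserves-parity : ∀ {m} k (c : Fin (suc (suc m))) → toℕ c ≡ suc (suc k) →
  ∀ x → Bijective _≡_ _≡_ x → parity (inversions (cyc3 zero (suc zero) c ∘ x)) ≡ parity (inversions x)
cycle01-preserves-parity zero c c≡2 x x-bij = begin
  parity (inversions (cyc3 zero (suc zero) c ∘ x))
    ≡⟨ cong parity (inversions-cong (λ i → cycle≗swaps zero (suc zero) c (λ ()) 0≢c 1≢c (x i))) ⟩
  parity (inversions (swap zero (suc zero) ∘ (swap (suc zero) c ∘ x)))
    ≡⟨ AdjacentSwap.flips-parity zero (suc zero) refl (swap (suc zero) c ∘ x) (bijective-∘ (swap-bijective (suc zero) c) x-bij) ⟩
  not (parity (inversions (swap (suc zero) c ∘ x)))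
    ≡⟨ cong not (AdjacentSwap.flips-parity (suc zero) c c≡2 x x-bij) ⟩
  not (not (parity (inversions x)))
    ≡⟨ not-involutive _ ⟩
  parity (inversions x) ∎
  where
  open ≡-Reasoning
  0≢c : Fin.zero ≢ c
  0≢c e = 0≢1+n (trans (cong toℕ e) c≡2)
  1≢c : Fin.suc zero ≢ c
  1≢c e = 0≢1+n (ℕₚ.suc-injective (trans (cong toℕ e) c≡2))
cycle01-preserves-parity {m} (suc k) c' c'≡k+3 x x-bij = begin
  parity (inversions (cyc3 zero (suc zero) c' ∘ x))
    ≡⟨ cong parity (inversions-cong (λ i → cycle≗conjugate zero (suc zero) c c' (λ ()) 0≢c 0≢c' 1≢c 1≢c' c≢c' (x i))) ⟩
  parity (inversions (swap c c' ∘ (cyc3 zero (suc zero) c ∘ (swap c c' ∘ x))))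
    ≡⟨ AdjacentSwap.flips-parity c c' c'≡c+1 (cyc3 zero (suc zero) c ∘ (swap c c' ∘ x))
         (bijective-∘ (cycle-bijective zero (suc zero) c (λ ()) 0≢c 1≢c) swapped-bij) ⟩
  not (parity (inversions (cyc3 zero (suc zero) c ∘ (swap c c' ∘ x))))
    ≡⟨ cong not (cycle01-preserves-parity k c c≡k+2 (swap c c' ∘ x) swapped-bij) ⟩
  not (parity (inversions (swap c c' ∘ x)))
    ≡⟨ cong not (AdjacentSwap.flips-parity c c' c'≡c+1 x x-bij) ⟩
  not (not (parity (inversions x)))
    ≡⟨ not-involutive _ ⟩
  parity (inversions x) ∎
  where
  open ≡-Reasoning
  k+2<m+2 : suc (suc k) < suc (suc m)
  k+2<m+2 = <-trans (n<1+n (suc (suc k))) (subst (_< suc (suc m)) c'≡k+3 (toℕ<n c'))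
  c : Fin (suc (suc m))
  c = fromℕ< k+2<m+2
  c≡k+2 : toℕ c ≡ suc (suc k)
  c≡k+2 = toℕ-fromℕ< k+2<m+2
  c'≡c+1 : toℕ c' ≡ suc (toℕ c)
  c'≡c+1 = trans c'≡k+3 (cong suc (sym c≡k+2))
  swapped-bij = bijective-∘ (swap-bijective c c') x-bij
  0≢c : Fin.zero ≢ c
  0≢c e = 0≢1+n (trans (cong toℕ e) c≡k+2)
  0≢c' : Fin.zero ≢ c'
  0≢c' e = 0≢1+n (trans (cong toℕ e) c'≡k+3)
  1≢c : Fin.suc zero ≢ c
  1≢c e = 0≢1+n (ℕₚ.suc-injective (trans (cong toℕ e) c≡k+2))
  1≢c' : Fin.suc zero ≢ c'
  1≢c' e = 0≢1+n (ℕₚ.suc-injective (trans (cong toℕ e) c'≡k+3))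
  c≢c' : c ≢ c'
  c≢c' e = <-irrefl (trans (sym c≡k+2) (trans (cong toℕ e) c'≡k+3)) (n<1+n (suc (suc k)))

gen-distinct : ∀ {m} (j : Fin m) → (Fin.zero {suc m} ≢ suc zero) × (Fin.zero ≢ suc (suc j)) × (Fin.suc {suc m} zero ≢ suc (suc j))
gen-distinct j = (λ ()) , (λ ()) , λ e → 0≢s (suc-injective e)
  where
  0≢s : ∀ {k} {i : Fin k} → Fin.zero ≢ suc i
  0≢s ()

gen-preserves-A : ∀ m (j : Fin m) x → InA x → InA (gen (suc (suc m)) j ∘ x)
gen-preserves-A m j x (x-bij , x-even) =
  bijective-∘ (cycle-bijective zero (suc zero) (suc (suc j)) 0≢1 0≢c 1≢c) x-bij ,
  parity-false⇒even _ (trans (cycle01-preserves-parity (toℕ j) (suc (suc j)) refl x x-bij) (even⇒parity-false _ x-even))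
  where
  0≢1 = proj₁ (gen-distinct j)
  0≢c = proj₁ (proj₂ (gen-distinct j))
  1≢c = proj₂ (proj₂ (gen-distinct j))

pow-preserves-A : ∀ m (j : Fin m) k x → InA x → InA (pow (gen (suc (suc m)) j) k ∘ x)
pow-preserves-A m j zero    x x∈A = x∈A
pow-preserves-A m j (suc k) x x∈A = gen-preserves-A m j (pow (gen (suc (suc m)) j) k ∘ x) (pow-preserves-A m j k x x∈A)

InA-≗ : ∀ {n} {x y : Perm n} → x ≗ y → InA y → InA x
InA-≗ x≗y (y-bij , y-even) = bijective-≗ (λ i → sym (x≗y i)) y-bij , subst (2 ∣_) (sym (inversions-cong x≗y)) y-even

-- Right cosets of the cyclic subgroup generated by one generator.

pow-+ : ∀ {n} (s : Perm n) a b → pow s (a + b) ≗ pow s a ∘ pow s b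
pow-+ s zero    b i = refl
pow-+ s (suc a) b i = cong s (pow-+ s a b i)

module Coset (m : ℕ) (j : Fin m) where
  N : ℕ
  N = suc (suc m)

  s : Perm N
  s = gen N j

  c : Fin N
  c = suc (suc j)

  0≢1 : Fin.zero {suc m} ≢ suc zero
  0≢1 = proj₁ (gen-distinct j)
  0≢c : Fin.zero ≢ c
  0≢c = proj₁ (proj₂ (gen-distinct j))
  1≢c : Fin.suc zero ≢ c
  1≢c = proj₂ (proj₂ (gen-distinct j))

  -- s has order 3, so every power of s is s⁰, s¹ or s².
  pow-3* : ∀ k → pow s (3 * k) ≗ id
  pow-3* zero    i = refl
  pow-3* (suc k) i = begin
    pow s (3 * suc k) i          ≡⟨ cong (λ e → pow s e i) (*-suc 3 k) ⟩
    pow s (3 + 3 * k) i          ≡⟨ pow-+ s 3 (3 * k) i ⟩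
    pow s 3 (pow s (3 * k) i)    ≡⟨ cycle-cubed zero (suc zero) c 0≢1 0≢c 1≢c _ ⟩
    pow s (3 * k) i              ≡⟨ pow-3* k i ⟩
    i                            ∎
    where open ≡-Reasoning

  pow-mod-3 : ∀ k → Σ (Fin 3) λ r → pow s k ≗ pow s (toℕ r)
  pow-mod-3 zero = zero , λ i → refl
  pow-mod-3 (suc k) with pow-mod-3 k
  ... | zero             , h = suc zero , λ i → cong s (h i)
  ... | suc zero         , h = suc (suc zero) , λ i → cong s (h i)
  ... | suc (suc zero)   , h = zero , λ i → trans (cong s (h i)) (cycle-cubed zero (suc zero) c 0≢1 0≢c 1≢c i)

  -- If y ∈ ⟨s⟩x then ⟨s⟩x = ⟨s⟩y (going back from y to x costs s^(2k) = s^(-k)).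
  same-coset : ∀ (x y : Perm N) k → y ≗ pow s k ∘ x → (j , x) ≈V (j , y)
  same-coset x y k y≗ = refl , λ g → to g , from g
    where
    to : ∀ g → g ∈C (j , x) → g ∈C (j , y)
    to g (t , g≗) = t + 2 * k , λ i → trans (g≗ i) (sym (begin
      pow s (t + 2 * k) (y i)             ≡⟨ cong (pow s (t + 2 * k)) (y≗ i) ⟩
      pow s (t + 2 * k) (pow s k (x i))   ≡⟨ pow-+ s (t + 2 * k) k (x i) ⟨
      pow s ((t + 2 * k) + k) (x i)       ≡⟨ cong (λ e → pow s e (x i)) (exponent t k) ⟩
      pow s (t + 3 * k) (x i)             ≡⟨ pow-+ s t (3 * k) (x i) ⟩
      pow s t (pow s (3 * k) (x i))       ≡⟨ cong (pow s t) (pow-3* k (x i)) ⟩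
      pow s t (x i)                       ∎))
      where
      open ≡-Reasoning
      exponent : ∀ t k → (t + 2 * k) + k ≡ t + 3 * k
      exponent = solve-∀
    from : ∀ g → g ∈C (j , y) → g ∈C (j , x)
    from g (t , g≗) = t + k , λ i → trans (g≗ i) (trans (cong (pow s t) (y≗ i)) (sym (pow-+ s t k (x i))))

  coset-of-member : ∀ (g y : Perm N) → g ∈C (j , y) → (j , y) ≈V (j , g)
  coset-of-member g y (t , g≗) = same-coset y g t g≗

  coset-≗ : ∀ (x y : Perm N) → x ≗ y → (j , x) ≈V (j , y)
  coset-≗ x y x≗y = same-coset x y 0 (λ i → sym (x≗y i))

  same-coset⁻¹ : ∀ (x y : Perm N) → (j , x) ≈V (j , y) → Σ (Fin 3) λ r → x ≗ pow s (toℕ r) ∘ y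
  same-coset⁻¹ x y (_ , same) with proj₁ (same x) (0 , λ i → refl)
  ... | t , x≗ = proj₁ (pow-mod-3 t) , λ i → trans (x≗ i) (proj₂ (pow-mod-3 t) (y i))

  -- The three elements s⁰x, s¹x, s²x of a coset are distinct: they differ at
  -- the point x⁻¹(0), where they take the values 0, 1, c.
  orbit-of-0 : ∀ (r : Fin 3) → Fin N
  orbit-of-0 r = pow s (toℕ r) zero

  s0≡1 : orbit-of-0 (suc zero) ≡ suc zero
  s0≡1 = cycle-a zero (suc zero) c
  s²0≡c : orbit-of-0 (suc (suc zero)) ≡ c
  s²0≡c = trans (cong s s0≡1) (cycle-b zero (suc zero) c (≢-sym 0≢1))

  orbit-of-0-injective : ∀ r r' → orbit-of-0 r ≡ orbit-of-0 r' → r ≡ r'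
  orbit-of-0-injective zero             zero             e = refl
  orbit-of-0-injective zero             (suc zero)       e = ⊥-elim (0≢1 (trans e s0≡1))
  orbit-of-0-injective zero             (suc (suc zero)) e = ⊥-elim (0≢c (trans e s²0≡c))
  orbit-of-0-injective (suc zero)       zero             e = ⊥-elim (0≢1 (trans (sym e) s0≡1))
  orbit-of-0-injective (suc zero)       (suc zero)       e = refl
  orbit-of-0-injective (suc zero)       (suc (suc zero)) e = ⊥-elim (1≢c (trans (sym s0≡1) (trans e s²0≡c)))
  orbit-of-0-injective (suc (suc zero)) zero             e = ⊥-elim (0≢c (trans (sym e) s²0≡c))
  orbit-of-0-injective (suc (suc zero)) (suc zero)       e = ⊥-elim (1≢c (sym (trans (sym s²0≡c) (trans e s0≡1))))
  orbit-of-0-injective (suc (suc zero)) (suc (suc zero)) e = refl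

  pow-distinct : ∀ (x : Perm N) → Bijective _≡_ _≡_ x → ∀ r r' → (pow s (toℕ r) ∘ x) ≗ (pow s (toℕ r') ∘ x) → r ≡ r'
  pow-distinct x (_ , x-sur) r r' e with x-sur zero
  ... | i , xi≡0 = orbit-of-0-injective r r'
    (trans (cong (pow s (toℕ r)) (sym (xi≡0 refl))) (trans (e i) (cong (pow s (toℕ r')) (xi≡0 refl))))

-- Orbits of an order-3 map without fixed points.  Let f act on a setoid with
-- f³ ~ id and a ≁ f a on the invariant predicate P.  A duplicate-free list in P
-- closed under f then splits into orbits {r, f r, f² r} of size 3; we extract
-- one representative per orbit, so the list has three times as many entries.
module FreeOrbits {A : Set} (_~_ : A → A → Set) (_~?_ : ∀ a b → Dec (a ~ b))
  (~-refl : ∀ {a} → a ~ a) (~-sym : ∀ {a b} → a ~ b → b ~ a) (~-trans : ∀ {a b c} → a ~ b → b ~ c → a ~ c)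
  (f : A → A) (f-cong : ∀ {a b} → a ~ b → f a ~ f b) (f³ : ∀ a → f (f (f a)) ~ a)
  (P : A → Set) (P-f : ∀ {a} → P a → P (f a)) (f-free : ∀ a → P a → ¬ a ~ f a) where

  Member : A → List A → Set
  Member a L = Any (a ~_) L

  Distinct : List A → Set
  Distinct = AllPairs (λ a b → ¬ a ~ b)

  Closed : List A → Set
  Closed L = All (λ a → Member (f a) L) L

  InOrbit : A → A → Set
  InOrbit r x = x ~ r ⊎ (x ~ f r ⊎ x ~ f (f r))

  member-resp : ∀ {a b} L → a ~ b → Member b L → Member a L
  member-resp L a~b = Any.map (~-trans a~b)

  member-tail : ∀ {x b} L → Member x (b ∷ L) → ¬ x ~ b → Member x L
  member-tail L (here x~b)  x≁b = ⊥-elim (x≁b x~b)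
  member-tail L (there x∈L) x≁b = x∈L

  closed-member : ∀ {x} L → Closed L → Member x L → Member (f x) L
  closed-member L closed x∈L with All.lookupAny closed x∈L
  ... | fd∈L , x~d = member-resp L (f-cong x~d) fd∈L

  ff-cong : ∀ {a b} → a ~ b → f (f a) ~ f (f b)
  ff-cong = f-cong ∘ f-cong

  fa≁a : ∀ {a} → P a → ¬ f a ~ a
  fa≁a {a} pa = f-free a pa ∘ ~-sym

  ffa≁a : ∀ {a} → P a → ¬ f (f a) ~ a
  ffa≁a {a} pa ffa~a = f-free a pa (~-trans (~-sym (f³ a)) (f-cong ffa~a))

  ffa≁fa : ∀ {a} → P a → ¬ f (f a) ~ f a
  ffa≁fa {a} pa = f-free (f a) (P-f pa) ∘ ~-sym

  inOrbit-sym : ∀ {r x} → InOrbit r x → InOrbit x r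
  inOrbit-sym (inj₁ x~r)        = inj₁ (~-sym x~r)
  inOrbit-sym (inj₂ (inj₁ x~fr)) = inj₂ (inj₂ (~-trans (~-sym (f³ _)) (ff-cong (~-sym x~fr))))
  inOrbit-sym (inj₂ (inj₂ x~ffr)) = inj₂ (inj₁ (~-trans (~-sym (f³ _)) (f-cong (~-sym x~ffr))))

  inOrbit-resp : ∀ {r x y} → InOrbit r x → x ~ y → InOrbit r y
  inOrbit-resp (inj₁ x~r)         x~y = inj₁ (~-trans (~-sym x~y) x~r)
  inOrbit-resp (inj₂ (inj₁ x~fr))  x~y = inj₂ (inj₁ (~-trans (~-sym x~y) x~fr))
  inOrbit-resp (inj₂ (inj₂ x~ffr)) x~y = inj₂ (inj₂ (~-trans (~-sym x~y) x~ffr))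

  inOrbit-f⁻¹ : ∀ {r c} → InOrbit r (f c) → InOrbit r c
  inOrbit-f⁻¹ {r} {c} (inj₁ fc~r)         = inj₂ (inj₂ (~-trans (~-sym (f³ c)) (ff-cong fc~r)))
  inOrbit-f⁻¹ {r} {c} (inj₂ (inj₁ fc~fr))  = inj₁ (~-trans (~-sym (f³ c)) (~-trans (ff-cong fc~fr) (f³ r)))
  inOrbit-f⁻¹ {r} {c} (inj₂ (inj₂ fc~ffr)) = inj₂ (inj₁ (~-trans (~-sym (f³ c)) (~-trans (ff-cong fc~ffr) (f-cong (f³ r)))))

  remove : A → List A → List A
  remove e = filter (λ x → ¬? (x ~? e))

  remove-all : ∀ {Q : A → Set} e L → All Q L → All (λ x → Q x × ¬ x ~ e) (remove e L)
  remove-all e L all-Q = All.zip (AllP.filter⁺ (λ x → ¬? (x ~? e)) all-Q , AllP.all-filter (λ x → ¬? (x ~? e)) L)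

  remove-keeps : ∀ {x} e L → Member x L → ¬ x ~ e → Member x (remove e L)
  remove-keeps e L x∈L x≁e with AnyP.filter⁺ (λ x → ¬? (x ~? e)) x∈L
  ... | inj₁ kept    = kept
  ... | inj₂ d~e-not = ⊥-elim (d~e-not (λ d~e → x≁e (~-trans (AnyP.lookup-result x∈L) d~e)))

  remove-⊆ : ∀ {x} e L → Member x (remove e L) → Member x L
  remove-⊆ e L = AnyP.filter⁻ (λ x → ¬? (x ~? e))

  remove-distinct : ∀ e L → Distinct L → Distinct (remove e L)
  remove-distinct e L = AllPairsP.filter⁺ (λ x → ¬? (x ~? e))

  remove-length : ∀ e L → Distinct L → Member e L → length L ≡ suc (length (remove e L))
  remove-length e (h ∷ t) (h≁t ∷ distinct) e∈L with h ~? e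
  ... | yes h~e = cong suc (sym (cong length (filter-all (λ x → ¬? (x ~? e))
                    (All.map (λ h≁x x~e → h≁x (~-trans h~e (~-sym x~e))) h≁t))))
  remove-length e (h ∷ t) (h≁t ∷ distinct) (here e~h)  | no h≁e = ⊥-elim (h≁e (~-sym e~h))
  remove-length e (h ∷ t) (h≁t ∷ distinct) (there e∈t) | no h≁e = cong suc (remove-length e t distinct e∈t)

  record OrbitRemoved (a : A) (L' : List A) : Set where
    field
      rest          : List A
      rest-P        : All P rest
      rest-distinct : Distinct rest
      rest-closed   : Closed rest
      rest-⊆        : ∀ x → Member x rest → Member x L'
      rest-outside  : All (λ x → ¬ InOrbit a x) rest
      rest-covers   : ∀ x → Member x L' → InOrbit a x ⊎ Member x rest
      rest-length   : length L' ≡ suc (suc (length rest))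

  removeOrbit : ∀ a L' → P a → All P L' → Distinct (a ∷ L') → Closed (a ∷ L') → OrbitRemoved a L'
  removeOrbit a L' pa pL' (a≁L' ∷ distinct) (fa∈ ∷ closed) = record
    { rest          = L₂
    ; rest-P        = All.map (λ { (((_ , px , _) , _) , _) → px }) facts
    ; rest-distinct = remove-distinct (f (f a)) L₁ (remove-distinct (f a) L' distinct)
    ; rest-closed   = All.map (λ {c} fact → f-stays c fact) facts
    ; rest-⊆        = λ x → remove-⊆ (f a) L' ∘ remove-⊆ (f (f a)) L₁
    ; rest-outside  = All.map (λ {x} fact → outside x fact) facts
    ; rest-covers   = covers
    ; rest-length   = trans (remove-length (f a) L' distinct fa∈L') (cong suc
                        (remove-length (f (f a)) L₁ (remove-distinct (f a) L' distinct) ffa∈L₁))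
    }
    where
    L₁ = remove (f a) L'
    L₂ = remove (f (f a)) L₁
    off-a : ∀ x → Member x L' → ¬ x ~ a
    off-a x x∈L' x~a with All.lookupAny a≁L' x∈L'
    ... | a≁d , x~d = a≁d (~-trans (~-sym x~a) x~d)
    fa∈L' : Member (f a) L'
    fa∈L' = member-tail L' fa∈ (fa≁a pa)
    ffa∈L₁ : Member (f (f a)) L₁
    ffa∈L₁ = remove-keeps (f a) L'
      (member-tail L' (closed-member (a ∷ L') (fa∈ ∷ closed) (there fa∈L')) (ffa≁a pa)) (ffa≁fa pa)
    Facts : A → Set
    Facts x = ((Member (f x) (a ∷ L') × P x × ¬ a ~ x) × ¬ x ~ f a) × ¬ x ~ f (f a)
    facts : All Facts L₂
    facts = remove-all (f (f a)) L₁ (remove-all (f a) L' (All.zip (closed , All.zip (pL' , a≁L'))))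
    outside : ∀ x → Facts x → ¬ InOrbit a x
    outside x (((_ , _ , a≁x) , x≁fa) , x≁ffa) = λ
      { (inj₁ x~a) → a≁x (~-sym x~a) ; (inj₂ (inj₁ x~fa)) → x≁fa x~fa ; (inj₂ (inj₂ x~ffa)) → x≁ffa x~ffa }
    keep : ∀ x → Member x L' → ¬ InOrbit a x → Member x L₂
    keep x x∈L' x∉orbit = remove-keeps (f (f a)) L₁ (remove-keeps (f a) L' x∈L' (x∉orbit ∘ inj₂ ∘ inj₁))
                            (x∉orbit ∘ inj₂ ∘ inj₂)
    covers : ∀ x → Member x L' → InOrbit a x ⊎ Member x L₂
    covers x x∈L' with x ~? f a | x ~? f (f a)
    ... | yes x~fa | _         = inj₁ (inj₂ (inj₁ x~fa))
    ... | no  _    | yes x~ffa = inj₁ (inj₂ (inj₂ x~ffa))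
    ... | no  x≁fa | no x≁ffa  = inj₂ (keep x x∈L' λ
      { (inj₁ x~a) → off-a x x∈L' x~a ; (inj₂ (inj₁ x~fa)) → x≁fa x~fa ; (inj₂ (inj₂ x~ffa)) → x≁ffa x~ffa })
    -- f c lies in a ∷ L' by closedness, and off the orbit of a since c is.
    f-stays : ∀ c → Facts c → Member (f c) L₂
    f-stays c fact@(((fc∈ , _) , _) , _) =
      keep (f c) (member-tail L' fc∈ (outside c fact ∘ inOrbit-f⁻¹ ∘ inj₁)) (outside c fact ∘ inOrbit-f⁻¹)

  record Representatives (L : List A) : Set where
    field
      reps      : List A
      reps-∈    : All (λ r → Member r L) reps
      covers    : ∀ x → Member x L → Any (λ r → InOrbit r x) reps
      separated : AllPairs (λ r r' → ¬ InOrbit r' r) reps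
      count     : 3 * length reps ≡ length L

  -- Peel off the orbit of the head repeatedly; fuel bounds the number of steps.
  representatives : ∀ fuel L → length L ≤ fuel → All P L → Distinct L → Closed L → Representatives L
  representatives fuel [] _ _ _ _ = record { reps = [] ; reps-∈ = [] ; covers = λ x () ; separated = [] ; count = refl }
  representatives (suc fuel) (a ∷ L') (s≤s L'≤fuel) (pa ∷ pL') distinct closed = record
    { reps      = a ∷ reps
    ; reps-∈    = here ~-refl ∷ All.map (λ r∈rest → there (rest-⊆ _ r∈rest)) reps-∈
    ; covers    = covers′
    ; separated = All.map (λ {r'} r'∈rest → apart r' r'∈rest) reps-∈ ∷ separated
    ; count     = trans (*-suc 3 (length reps)) (trans (cong (3 +_) count) (sym (cong suc rest-length)))
    }
    where
    removed = removeOrbit a L' pa pL' distinct closed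
    open OrbitRemoved removed
    rest≤fuel : length rest ≤ fuel
    rest≤fuel = ≤-trans (n≤1+n _) (≤-trans (n≤1+n _) (≤-trans (≤-reflexive (sym rest-length)) L'≤fuel))
    open Representatives (representatives fuel rest rest≤fuel rest-P rest-distinct rest-closed)
    covers′ : ∀ x → Member x (a ∷ L') → Any (λ r → InOrbit r x) (a ∷ reps)
    covers′ x (here x~a) = here (inj₁ x~a)
    covers′ x (there x∈L') with rest-covers x x∈L'
    ... | inj₁ in-orbit  = here in-orbit
    ... | inj₂ x∈rest    = there (covers x x∈rest)
    apart : ∀ r' → Member r' rest → ¬ InOrbit r' a
    apart r' r'∈rest r'-orbit with All.lookupAny rest-outside r'∈rest
    ... | d∉orbit , r'~d = d∉orbit (inOrbit-resp (inOrbit-sym r'-orbit) r'~d)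

module Blocks {I X B : Set} (_≈_ : B → B → Set) (φ : I → X → B) (xs : I → List X) where
  union : List I → List B
  union = concatMap (λ i → map (φ i) (xs i))

  union-all : ∀ {Q : B → Set} is → All (λ i → All (Q ∘ φ i) (xs i)) is → All Q (union is)
  union-all is all-Q = AllP.concat⁺ (AllP.map⁺ (All.map AllP.map⁺ all-Q))

  union-any : ∀ {Q : B → Set} is → Any (λ i → Any (Q ∘ φ i) (xs i)) is → Any Q (union is)
  union-any is any-Q = AnyP.concat⁺ (AnyP.map⁺ (Any.map AnyP.map⁺ any-Q))

  union-distinct : ∀ {_≉ᵢ_ : I → I → Set} is → AllPairs _≉ᵢ_ is →
    (∀ i → AllPairs (λ x y → ¬ φ i x ≈ φ i y) (xs i)) →
    (∀ {i i'} → i ≉ᵢ i' → ∀ x y → ¬ φ i x ≈ φ i' y) →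
    AllPairs (λ a b → ¬ a ≈ b) (union is)
  union-distinct is is-distinct within across = AllPairsP.concat⁺
    (AllP.map⁺ (All.universal (λ i → AllPairsP.map⁺ (within i)) is))
    (AllPairsP.map⁺ (AllPairs.map (λ {i} {i'} i≉i' →
      AllP.map⁺ (All.universal (λ x → AllP.map⁺ (All.universal (λ y → across i≉i' x y) (xs i'))) (xs i))) is-distinct))

  union-length : ∀ c is → (∀ i → length (xs i) ≡ c) → length (union is) ≡ length is * c
  union-length c is len = trans (length-concatMap (λ i → map (φ i) (xs i)) is)
    (sum-const is c (λ i → trans (length-map (φ i) (xs i)) (len i)))

allFin-distinct : ∀ n → AllPairs _≢_ (allFin n)
allFin-distinct n = AllPairsP.tabulate⁺ id

pairs : ∀ K → List (Fin K × Fin K)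
pairs zero    = []
pairs (suc K) = map (λ t → (zero , suc t)) (allFin K) ++ map (λ pr → (suc (proj₁ pr) , suc (proj₂ pr))) (pairs K)

pairs-< : ∀ K → All (λ pr → proj₁ pr <ᶠ proj₂ pr) (pairs K)
pairs-< zero    = []
pairs-< (suc K) = AllP.++⁺ (AllP.map⁺ (AllP.tabulate⁺ (λ t → s≤s z≤n))) (AllP.map⁺ (All.map s≤s (pairs-< K)))

pairs-distinct : ∀ K → AllPairs _≢_ (pairs K)
pairs-distinct zero    = []
pairs-distinct (suc K) = AllPairsP.++⁺
  (AllPairsP.map⁺ (AllPairsP.tabulate⁺ (λ t≢t' e → t≢t' (suc-injective (cong proj₂ e)))))
  (AllPairsP.map⁺ (AllPairs.map (λ pr≢pr' e → pr≢pr' (cong₂ _,_ (suc-injective (cong proj₁ e)) (suc-injective (cong proj₂ e))))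
    (pairs-distinct K)))
  (AllP.map⁺ (All.universal (λ t → AllP.map⁺ (All.universal (λ pr ()) (pairs K))) (allFin K)))

pairs-complete : ∀ K (a b : Fin K) → a <ᶠ b → Any ((a , b) ≡_) (pairs K)
pairs-complete (suc K) zero    (suc b) _         = AnyP.++⁺ˡ (AnyP.map⁺ (AnyP.tabulate⁺ {f = id} b refl))
pairs-complete (suc K) (suc a) (suc b) (s≤s a<b) = AnyP.++⁺ʳ (map (λ t → (zero , suc t)) (allFin K))
  (AnyP.map⁺ (Any.map (cong (λ pr → (suc (proj₁ pr) , suc (proj₂ pr)))) (pairs-complete K a b a<b)))

pairs-length : ∀ K → length (pairs K) * 2 + K ≡ K * K
pairs-length zero    = refl
pairs-length (suc K) = begin
    length (pairs (suc K)) * 2 + suc K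
  ≡⟨ cong (λ l → l * 2 + suc K) (trans (length-++ (map (λ t → (zero , suc t)) (allFin K)))
        (cong₂ _+_ (trans (length-map _ (allFin K)) (length-tabulate {n = K} id)) (length-map _ (pairs K)))) ⟩
    (K + length (pairs K)) * 2 + suc K
  ≡⟨ regroup K (length (pairs K)) ⟩
    (length (pairs K) * 2 + K) + (2 * K + 1)
  ≡⟨ cong (_+ (2 * K + 1)) (pairs-length K) ⟩
    K * K + (2 * K + 1)
  ≡⟨ square-suc K ⟩
    suc K * suc K
  ∎
  where
  open ≡-Reasoning
  regroup : ∀ K p → (K + p) * 2 + suc K ≡ (p * 2 + K) + (2 * K + 1)
  regroup = solve-∀
  square-suc : ∀ K → K * K + (2 * K + 1) ≡ suc K * suc K
  square-suc = solve-∀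

≈V-sym : ∀ {n} {v w : VRep n} → v ≈V w → w ≈V v
≈V-sym (s≡t , same) = sym s≡t , λ g → proj₂ (same g) , proj₁ (same g)

≈V-trans : ∀ {n} {u v w : VRep n} → u ≈V v → v ≈V w → u ≈V w
≈V-trans (e , same) (e' , same') = trans e e' , λ g → proj₁ (same' g) ∘ proj₁ (same g) , proj₂ (same g) ∘ proj₂ (same' g)

≈I-sym : ∀ {n} {a b : VRep n × Perm n} → a ≈I b → b ≈I a
≈I-sym (v≈w , g≗h) = ≈V-sym v≈w , λ i → sym (g≗h i)

≈E-sym : ∀ {n} {a b : VRep n × VRep n × Perm n} → a ≈E b → b ≈E a
≈E-sym (v≈v' , w≈w' , g≗h) = ≈V-sym v≈v' , ≈V-sym w≈w' , λ i → sym (g≗h i)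

_≗?_ : ∀ {n} (σ τ : Perm n) → Dec (σ ≗ τ)
σ ≗? τ = all? (λ i → σ i ≟ τ i)

module Counting (k : ℕ) where
  m : ℕ
  m = suc (suc k)

  n : ℕ
  n = suc (suc m)

  -- A_n as a list; kept opaque so that its recursive definition is never
  -- unfolded during type checking.
  opaque
    An : List (Perm n)
    An = permsOfParity n false

  opaque
    unfolding An

    An-InA : All InA An
    An-InA = All.zipWith (λ { (σ-perm , σ-par) → proj₁ σ-perm , parity-false⇒even _ σ-par })
      (permsOfParity-isPerm n false , permsOfParity-parity n false)

    An-distinct : AllPairs (λ σ τ → ¬ σ ≗ τ) An
    An-distinct = permsOfParity-distinct n false

    An-complete : ∀ x → InA x → Any (x ≗_) An
    An-complete x (x-bij , x-even) =
      subst (λ b → Any (x ≗_) (permsOfParity n b)) (even⇒parity-false _ x-even) (permsOfParity-complete n x x-bij)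

    An-length : length An * 2 ≡ n !
    An-length = permsOfParity-length m false

  An-member-InA : ∀ {x} → Any (x ≗_) An → InA x
  An-member-InA x∈An with All.lookupAny An-InA x∈An
  ... | g∈A , x≗g = InA-≗ x≗g g∈A

  partite : Partite n
  partite v w _ _ same-class (different-class , _) = different-class same-class

  -- Within class j, the vertices are the orbits of x ↦ s x on A_n.
  module Class (j : Fin m) where
    open Coset m j public
    s-free : ∀ x → InA x → ¬ x ≗ (s ∘ x)
    s-free x (x-bij , _) x≗sx with pow-distinct x x-bij zero (suc zero) x≗sx
    ... | ()
    open FreeOrbits _≗_ _≗?_ (λ _ → refl) (λ e i → sym (e i)) (λ e e' i → trans (e i) (e' i))
      (s ∘_) (λ e i → cong s (e i)) (λ a i → cycle-cubed zero (suc zero) c 0≢1 0≢c 1≢c (a i))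
      InA (λ {a} → gen-preserves-A m j a) s-free public
    open Representatives (representatives (length An) An ≤-refl An-InA An-distinct
      (All.map (λ {a} a∈A → An-complete (s ∘ a) (gen-preserves-A m j a a∈A)) An-InA)) public

    inOrbit⇒≈V : ∀ x r → InOrbit r x → (j , x) ≈V (j , r)
    inOrbit⇒≈V x r (inj₁ x≗r)         = ≈V-sym (same-coset r x 0 x≗r)
    inOrbit⇒≈V x r (inj₂ (inj₁ x≗sr))  = ≈V-sym (same-coset r x 1 x≗sr)
    inOrbit⇒≈V x r (inj₂ (inj₂ x≗ssr)) = ≈V-sym (same-coset r x 2 x≗ssr)

    ≈V⇒inOrbit : ∀ x r → (j , x) ≈V (j , r) → InOrbit r x
    ≈V⇒inOrbit x r x≈r with same-coset⁻¹ x r x≈r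
    ... | zero           , x≗ = inj₁ x≗
    ... | suc zero       , x≗ = inj₂ (inj₁ x≗)
    ... | suc (suc zero) , x≗ = inj₂ (inj₂ x≗)

  module V = Blocks (_≈V_ {n}) (λ j r → (j , r)) Class.reps

  vertex-enumeration : Enumeration _≈V_ (IsVertex n) (V.union (allFin m))
  vertex-enumeration = record
    { entries-P = V.union-all (allFin m) (All.universal (λ j → All.map An-member-InA (Class.reps-∈ j)) (allFin m))
    ; distinct  = V.union-distinct (allFin m) (allFin-distinct m)
        (λ j → AllPairs.map (λ {r} {r'} apart r≈r' → apart (Class.≈V⇒inOrbit j r r' r≈r')) (Class.separated j))
        (λ j≢j' r r' r≈r' → j≢j' (proj₁ r≈r'))
    ; complete  = λ { (j , x) x∈A → V.union-any (allFin m) (AnyP.tabulate⁺ {f = id} j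
        (Any.map (λ {r} → Class.inOrbit⇒≈V j x r) (Class.covers j x (An-complete x x∈A)))) }
    }

  q : ℕ
  q = length (Class.reps zero)

  class-size : ∀ j → length (Class.reps j) ≡ q
  class-size j = *-cancelˡ-≡ (length (Class.reps j)) q 3 (trans (Class.count j) (sym (Class.count zero)))

  vertex-count : length (V.union (allFin m)) ≡ (n ! * (n ∸ 2)) / 6
  vertex-count = begin
      length (V.union (allFin m))  ≡⟨ V.union-length q (allFin m) class-size ⟩
      length (allFin m) * q        ≡⟨ cong (_* q) (length-tabulate {n = m} id) ⟩
      m * q                        ≡⟨ m*n/n≡m (m * q) 6 ⟨
      (m * q) * 6 / 6              ≡⟨ cong (_/ 6) six-fold ⟨
      (n ! * m) / 6                ∎
    where
    open ≡-Reasoning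
    six-fold : n ! * m ≡ (m * q) * 6
    six-fold = begin
      n ! * m                 ≡⟨ cong (_* m) (trans (sym An-length) (cong (_* 2) (sym (Class.count zero)))) ⟩
      ((3 * q) * 2) * m       ≡⟨ regroup q m ⟩
      (m * q) * 6             ∎
      where
      regroup : ∀ q m → ((3 * q) * 2) * m ≡ (m * q) * 6
      regroup = solve-∀

  -- Incidences at the vertex ⟨s⟩x of class j₀: for each of the other classes
  -- t and each of the three elements sʳx of the coset, the vertex ⟨t⟩sʳx.
  module Incidence (j₀ : Fin m) (x : Perm n) (x∈A : InA x) where
    open Class j₀ using (s; pow-mod-3; pow-distinct)

    element : Fin 3 → Perm n
    element r = pow s (toℕ r) ∘ x

    module I = Blocks (_≈I_ {n}) (λ t' r → ((punchIn j₀ t' , element r) , element r)) (λ _ → allFin 3)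

    enumeration : Enumeration _≈I_ (IncidentAt n (j₀ , x)) (I.union (allFin (suc k)))
    enumeration = record
      { entries-P = I.union-all (allFin (suc k)) (All.universal (λ t' → AllP.tabulate⁺ {f = id} (λ r →
          let sʳx∈A = pow-preserves-A m j₀ (toℕ r) x x∈A
          in sʳx∈A , punchInᵢ≢i j₀ t' , sʳx∈A , (toℕ r , λ i → refl) , (0 , λ i → refl))) (allFin (suc k)))
      ; distinct  = I.union-distinct (allFin (suc k)) (allFin-distinct (suc k))
          (λ t' → AllPairsP.tabulate⁺ {f = id} (λ {r} {r'} r≢r' e → r≢r' (pow-distinct x (proj₁ x∈A) r r' (proj₂ e))))
          (λ t'≢t'' r r' e → t'≢t'' (punchIn-injective j₀ _ _ (proj₁ (proj₁ e))))
      ; complete  = complete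
      }
      where
      complete : ∀ a → IncidentAt n (j₀ , x) a → Any (a ≈I_) (I.union (allFin (suc k)))
      complete ((t , y) , h) (_ , t≢j₀ , _ , (e , h≗) , h∈ty) =
        I.union-any (allFin (suc k)) (AnyP.tabulate⁺ {f = id} t' (AnyP.tabulate⁺ {f = id} r
          (subst (λ t₁ → ((t , y) , h) ≈I ((t₁ , element r) , element r)) (sym t≡) 
            (≈V-trans (Class.coset-of-member t h y h∈ty) (Class.coset-≗ t h (element r) h≗sʳx) , h≗sʳx))))
        where
        t' = punchOut {i = j₀} {j = t} (t≢j₀ ∘ sym)
        t≡ : punchIn j₀ t' ≡ t
        t≡ = punchIn-punchOut _
        r = proj₁ (pow-mod-3 e)
        h≗sʳx : h ≗ element r
        h≗sʳx i = trans (h≗ i) (proj₂ (pow-mod-3 e) (x i))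

    count : length (I.union (allFin (suc k))) ≡ 3 * (n ∸ 3)
    count = trans (I.union-length 3 (allFin (suc k)) (λ _ → length-tabulate {n = 3} id))
      (trans (cong (_* 3) (length-tabulate {n = suc k} id)) (*-comm (suc k) 3))

  incidences : ∀ v → IsVertex n v → HasCard (_≈I_ {n}) (IncidentAt n v) (3 * (n ∸ 3))
  incidences (j₀ , x) x∈A = subst (HasCard _≈I_ (IncidentAt n (j₀ , x))) (Incidence.count j₀ x x∈A)
    (enumeration⇒card ≈I-sym (Incidence.enumeration j₀ x x∈A))

  -- Edges: one for each g ∈ A_n and each pair of classes a < b, joining the
  -- cosets of g in classes a and b.
  module E = Blocks (_≈E_ {n}) (λ g pr → ((proj₁ pr , g) , (proj₂ pr , g) , g)) (λ _ → pairs m)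

  edge-enumeration : Enumeration _≈E_ (IsEdge n) (E.union An)
  edge-enumeration = record
    { entries-P = E.union-all An (All.map (λ {g} g∈A → All.map (λ a<b →
        g∈A , g∈A , a<b , g∈A , (0 , λ _ → refl) , (0 , λ _ → refl)) (pairs-< m)) An-InA)
    ; distinct  = E.union-distinct An An-distinct
        (λ g → AllPairs.map (λ pr≢pr' e → pr≢pr' (cong₂ _,_ (proj₁ (proj₁ e)) (proj₁ (proj₁ (proj₂ e))))) (pairs-distinct m))
        (λ g≉g' pr pr' e → g≉g' (proj₂ (proj₂ e)))
    ; complete  = complete
    }
    where
    complete : ∀ a → IsEdge n a → Any (a ≈E_) (E.union An)
    complete ((a , x) , (b , y) , h) (_ , _ , a<b , h∈A , h∈ax , h∈by) =
      E.union-any An (Any.map (λ {g} h≗g → Any.map (λ { refl →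
          ≈V-trans (Class.coset-of-member a h x h∈ax) (Class.coset-≗ a h g h≗g)
        , ≈V-trans (Class.coset-of-member b h y h∈by) (Class.coset-≗ b h g h≗g)
        , h≗g }) (pairs-complete m a b a<b)) (An-complete h h∈A))

  edge-count : length (E.union An) ≡ (n ! * (n ∸ 2) * (n ∸ 3)) / 4
  edge-count = begin
      length (E.union An)            ≡⟨ E.union-length p An (λ _ → refl) ⟩
      length An * p                  ≡⟨ m*n/n≡m (length An * p) 4 ⟨
      (length An * p) * 4 / 4        ≡⟨ cong (_/ 4) four-fold ⟨
      (n ! * m * suc k) / 4          ∎
    where
    open ≡-Reasoning
    p = length (pairs m)
    two-p : p * 2 ≡ m * suc k
    two-p = +-cancelʳ-≡ m (p * 2) (m * suc k) (trans (pairs-length m) (square k))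
      where
      square : ∀ k → (2 + k) * (2 + k) ≡ (2 + k) * suc k + (2 + k)
      square = solve-∀
    four-fold : n ! * m * suc k ≡ (length An * p) * 4
    four-fold = begin
      n ! * m * suc k                  ≡⟨ cong (λ z → z * m * suc k) (sym An-length) ⟩
      length An * 2 * m * suc k        ≡⟨ assoc (length An) m (suc k) ⟩
      length An * 2 * (m * suc k)      ≡⟨ cong (λ z → length An * 2 * z) (sym two-p) ⟩
      length An * 2 * (p * 2)          ≡⟨ regroup (length An) p ⟩
      (length An * p) * 4              ∎
      where
      assoc : ∀ a b c → a * 2 * b * c ≡ a * 2 * (b * c)
      assoc = solve-∀
      regroup : ∀ a p → a * 2 * (p * 2) ≡ (a * p) * 4
      regroup = solve-∀

  vertices : HasCard (_≈V_ {n}) (IsVertex n) ((n ! * (n ∸ 2)) / 6)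
  vertices = subst (HasCard _≈V_ (IsVertex n)) vertex-count (enumeration⇒card ≈V-sym vertex-enumeration)

  edges : HasCard (_≈E_ {n}) (IsEdge n) ((n ! * (n ∸ 2) * (n ∸ 3)) / 4)
  edges = subst (HasCard _≈E_ (IsEdge n)) edge-count (enumeration⇒card ≈E-sym edge-enumeration)

theorem4p6p2 : ∀ n → 3 < n →
    Partite n
    × (∀ v → IsVertex n v → HasCard (_≈I_ {n}) (IncidentAt n v) (3 * (n ∸ 3)))
    × HasCard (_≈E_ {n}) (IsEdge n) ((n ! * (n ∸ 2) * (n ∸ 3)) / 4)
    × HasCard (_≈V_ {n}) (IsVertex n) ((n ! * (n ∸ 2)) / 6)
theorem4p6p2 zero                      ()
theorem4p6p2 (suc zero)                (s≤s ())
theorem4p6p2 (suc (suc zero))          (s≤s (s≤s ()))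
theorem4p6p2 (suc (suc (suc zero)))    (s≤s (s≤s (s≤s ())))
theorem4p6p2 (suc (suc (suc (suc k)))) _ = partite , incidences , edges , vertices
  where open Counting k
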